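{- Let $k$ be a nonnegative integer and let $Q_k$ be the poset consisting of one minimal element covered by $k$ other elements. For any integer $j$ with $1\le j\le k-1$, the coefficient of $t^j$ in the Ehrhart polynomial $i(\mathcal{O}_{Q_k},t)$ is negative if and only if $k-j+1\ge 20$ and $4$ divides $k-j+1$. Consequently, the order polytope $\mathcal{O}_{Q_k}$ is Ehrhart positive if and only if $k<20$.
   Context: For a finite poset $(P,\le_P)$, the order polytope $\mathcal{O}_P\subset\mathbb{R}^P$ is the set of functions $f:P\to\mathbb{R}$ with $0\le f(i)\le 1$ for all $i\in P$ and $f(i)\le f(j)$ whenever $i\le_P j$; it is a lattice polytope of dimension $|P|$. For an integral polytope $\mathcal{P}$, the Ehrhart polynomial $i(\mathcal{P},t)$ is the polynomial in $t$ with $i(\mathcal{P},t)=|t\mathcal{P}\cap\mathbb{Z}^e|$ for all positive integers $t$. An integral polytope is called Ehrhart positive if all coefficients of its Ehrhart polynomial are positive. -}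

module Defs where

open import Level using (0ℓ)
open import Data.Nat as ℕ using (ℕ; zero; suc; _≤_; _≤?_)
open import Data.Fin using (Fin)
import Data.Fin as Fin
open import Data.Fin.Properties using (all?) renaming (_≟_ to _≟F_)
open import Data.Vec using (Vec; []; _∷_; lookup)
open import Data.List using (List; []; _∷_; concatMap; map; filter; length; upTo)
open import Data.Integer using (+_)
open import Data.Rational using (ℚ; 0ℚ; _+_; _*_; _/_)
open import Data.Sum using (_⊎_; inj₁; inj₂)
open import Data.Product using (_,_)
open import Relation.Binary using (Rel; Decidable; IsPartialOrder; IsPreorder)
open import Relation.Binary.PropositionalEquality using (_≡_; refl; sym; trans; isEquivalence)
open import Relation.Nullary using (Dec; yes; no; _→-dec_)
open import Relation.Nullary.Decidable using (_⊎-dec_)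

record FinPoset (n : ℕ) : Set₁ where
  field
    _≼_       : Rel (Fin n) 0ℓ
    isPartialOrder : IsPartialOrder _≡_ _≼_
    _≼?_      : Decidable _≼_

-- Lattice points of t·𝒪_P: integer vectors f ∈ ℤ^P with 0 ≤ f(i) ≤ t
-- and f(i) ≤ f(j) whenever i ≼ j.  Nonnegative integers are represented
-- as natural numbers.

box : ℕ → (n : ℕ) → List (Vec ℕ n)
box t zero    = [] ∷ []
box t (suc n) = concatMap (λ v → map (_∷ v) (upTo (suc t))) (box t n)

module _ {n : ℕ} (P : FinPoset n) where
  open FinPoset P

  OrderPreserving : Vec ℕ n → Set
  OrderPreserving f = ∀ i j → i ≼ j → lookup f i ≤ lookup f j

  orderPreserving? : (f : Vec ℕ n) → Dec (OrderPreserving f)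
  orderPreserving? f =
    all? (λ i → all? (λ j → (i ≼? j) →-dec (lookup f i ≤? lookup f j)))

  latticeCount : ℕ → ℕ
  latticeCount t = length (filter orderPreserving? (box t n))

-- Polynomials with rational coefficients, as coefficient lists
-- (constant term first).

Poly : Set
Poly = List ℚ

eval : Poly → ℚ → ℚ
eval []       x = 0ℚ
eval (a ∷ as) x = a + x * eval as x

coeff : Poly → ℕ → ℚ
coeff []       j       = 0ℚ
coeff (a ∷ as) zero    = a
coeff (a ∷ as) (suc j) = coeff as j

ℕ→ℚ : ℕ → ℚ
ℕ→ℚ m = (+ m) / 1

IsEhrhartPolyOfOrderPolytope : {n : ℕ} → FinPoset n → Poly → Set
IsEhrhartPolyOfOrderPolytope {n} P p =
  ∀ t → 1 ≤ t → eval p (ℕ→ℚ t) ≡ ℕ→ℚ (latticeCount P t)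

EhrhartPositive : ℕ → Poly → Set
EhrhartPositive d p = ∀ j → j ≤ d → 0ℚ Data.Rational.< coeff p j

-- The poset Q_k on Fin (suc k): element 0 is the unique minimal element,
-- covered by the k other elements (which are pairwise incomparable).

_≼Q_ : {k : ℕ} → Rel (Fin (suc k)) 0ℓ
x ≼Q y = (x ≡ y) ⊎ (x ≡ Fin.zero)

≼Q-trans : {k : ℕ} {x y z : Fin (suc k)} → x ≼Q y → y ≼Q z → x ≼Q z
≼Q-trans (inj₁ refl) q = q
≼Q-trans (inj₂ e) _ = inj₂ e

≼Q-antisym : {k : ℕ} {x y : Fin (suc k)} → x ≼Q y → y ≼Q x → x ≡ y
≼Q-antisym (inj₁ e) _ = e
≼Q-antisym (inj₂ e) (inj₁ e′) = sym e′
≼Q-antisym (inj₂ e) (inj₂ e′) = trans e (sym e′)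

Q : (k : ℕ) → FinPoset (suc k)
Q k = record
  { _≼_ = _≼Q_
  ; isPartialOrder = record
      { isPreorder = record
          { isEquivalence = isEquivalence
          ; reflexive = inj₁
          ; trans = ≼Q-trans
          }
      ; antisym = ≼Q-antisym
      }
  ; _≼?_ = λ x y → (x ≟F y) ⊎-dec (x ≟F Fin.zero)
  }

module Submission where

-- Counting lattice points by the value at the minimum gives i(t) = Σ_{m≤t+1} mᵏ,
-- and Faulhaber's formula with the Bernoulli series β = x/(eˣ − 1) shows that
-- the coefficient of tʲ is (k!/j!)·(β_m + 1/(m−1)!).  Its sign comes from a
-- Riccati equation for β: it forces β_m = 0 for odd m ≥ 3 and β_{2r+2} =
-- (−1)ʳ·bmag_r for a positive sequence bmag with a convolution recursion,
-- under which bmag_r > 1/(2r+1)! from r = 8 on; m ≤ 18 is checked on the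
-- exact values.

open import Defs
open import Level using (0ℓ)
open import Data.Bool using (true; false)
open import Data.Nat as ℕ using (ℕ; zero; suc; z≤n; s≤s)
import Data.Nat.Properties as ℕP
import Data.Nat.Tactic.RingSolver as ℕ-Solver
open import Data.Nat.Divisibility using (_∣_; divides; ∣-trans; n∣m⇒m%n≡0)
open import Data.Nat.DivMod using ([m+kn]%n≡m%n)
open import Data.Nat.Induction using (<-rec)
open import Data.Nat.ListAction using (sum)
open import Data.Integer as ℤ using ()
import Data.Integer.Properties as ℤP
open import Data.Rational using (ℚ; 0ℚ; 1ℚ; _+_; _*_; _-_; -_; _<_; _≤_; _/_; 1/_; toℚᵘ; Positive; positive; nonNegative)
open import Data.Rational.Properties
import Data.Rational.Unnormalised as ℚᵘ
import Data.Rational.Unnormalised.Properties as ℚᵘP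
open import Data.Fin using (Fin; zero; suc; toℕ; fromℕ<)
open import Data.Fin.Properties using (all?; toℕ-fromℕ<)
open import Data.List using (List; []; _∷_; _++_; length; filter; map; concatMap; upTo; applyUpTo)
open import Data.List.Properties
  using (filter-++; filter-≐; filter-accept; filter-reject; filter-none; filter-all; length-++; map-cong; upTo-∷ʳ; map-applyUpTo)
import Data.List.Relation.Unary.All as All
open import Data.Vec using (Vec; _∷_; lookup)
open import Data.Product using (Σ; _×_; _,_; proj₁; proj₂)
open import Data.Sum using (_⊎_; inj₁; inj₂)
open import Function using (_∘_; id)
open import Function.Bundles using (_⇔_; mk⇔; Equivalence)
open Equivalence using (to; from)
open import Relation.Unary using (Pred; Decidable)
open import Relation.Binary using (Tri; tri<; tri≈; tri>)
open import Relation.Binary.PropositionalEquality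
open import Relation.Nullary using (Dec; does; yes; no; ¬_; _→-dec_; _×-dec_)
open import Relation.Nullary.Decidable using (True; toWitness)
open import Relation.Nullary.Decidable.Core using (dec⇒maybe)
open import Relation.Nullary.Negation using (contradiction)
open import Tactic.RingSolver using (solve-∀)
open import Tactic.RingSolver.Core.AlmostCommutativeRing using (AlmostCommutativeRing; fromCommutativeRing)

ℚ-ring : AlmostCommutativeRing _ _
ℚ-ring = fromCommutativeRing +-*-commutativeRing (λ x → dec⇒maybe (0ℚ ≟ x))

module Embedding where
  open ≡-Reasoning

  toℚᵘ-ℕ→ℚ : ∀ m → toℚᵘ (ℕ→ℚ m) ℚᵘ.≃ ℚᵘ.mkℚᵘ (ℤ.+ m) 0
  toℚᵘ-ℕ→ℚ m = toℚᵘ-fromℚᵘ (ℚᵘ.mkℚᵘ (ℤ.+ m) 0)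

  ℕ→ℚ-suc : ∀ m → ℕ→ℚ (suc m) ≡ 1ℚ + ℕ→ℚ m
  ℕ→ℚ-suc m = toℚᵘ-injective (ℚᵘP.≃-trans (toℚᵘ-ℕ→ℚ (suc m)) (ℚᵘP.≃-sym
    (ℚᵘP.≃-trans (toℚᵘ-homo-+ 1ℚ (ℕ→ℚ m))
    (ℚᵘP.≃-trans (ℚᵘP.+-cong {toℚᵘ 1ℚ} ℚᵘP.≃-refl (toℚᵘ-ℕ→ℚ m)) integral-sum))))
    where
    integral-sum : ℚᵘ.mkℚᵘ (ℤ.+ 1) 0 ℚᵘ.+ ℚᵘ.mkℚᵘ (ℤ.+ m) 0 ℚᵘ.≃ ℚᵘ.mkℚᵘ (ℤ.+ suc m) 0
    integral-sum = ℚᵘ.*≡* (trans (ℤP.*-identityʳ _)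
      (trans (cong (ℤ._+_ (ℤ.+ 1)) (ℤP.*-identityʳ (ℤ.+ m))) (sym (ℤP.*-identityʳ _))))

  ℕ→ℚ-+ : ∀ m n → ℕ→ℚ (m ℕ.+ n) ≡ ℕ→ℚ m + ℕ→ℚ n
  ℕ→ℚ-+ zero n = sym (+-identityˡ _)
  ℕ→ℚ-+ (suc m) n = begin
    ℕ→ℚ (suc (m ℕ.+ n))    ≡⟨ ℕ→ℚ-suc (m ℕ.+ n) ⟩
    1ℚ + ℕ→ℚ (m ℕ.+ n)     ≡⟨ cong (1ℚ +_) (ℕ→ℚ-+ m n) ⟩
    1ℚ + (ℕ→ℚ m + ℕ→ℚ n)   ≡⟨ sym (+-assoc 1ℚ (ℕ→ℚ m) (ℕ→ℚ n)) ⟩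
    (1ℚ + ℕ→ℚ m) + ℕ→ℚ n   ≡⟨ cong (_+ ℕ→ℚ n) (sym (ℕ→ℚ-suc m)) ⟩
    ℕ→ℚ (suc m) + ℕ→ℚ n    ∎

  ℕ→ℚ-* : ∀ m n → ℕ→ℚ (m ℕ.* n) ≡ ℕ→ℚ m * ℕ→ℚ n
  ℕ→ℚ-* zero n = sym (*-zeroˡ (ℕ→ℚ n))
  ℕ→ℚ-* (suc m) n = begin
    ℕ→ℚ (n ℕ.+ m ℕ.* n)      ≡⟨ ℕ→ℚ-+ n (m ℕ.* n) ⟩
    ℕ→ℚ n + ℕ→ℚ (m ℕ.* n)    ≡⟨ cong (ℕ→ℚ n +_) (ℕ→ℚ-* m n) ⟩
    ℕ→ℚ n + ℕ→ℚ m * ℕ→ℚ n    ≡⟨ distrib (ℕ→ℚ n) (ℕ→ℚ m) ⟩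
    (1ℚ + ℕ→ℚ m) * ℕ→ℚ n     ≡⟨ cong (_* ℕ→ℚ n) (sym (ℕ→ℚ-suc m)) ⟩
    ℕ→ℚ (suc m) * ℕ→ℚ n      ∎
    where
    distrib : ∀ x y → x + y * x ≡ (1ℚ + y) * x
    distrib = solve-∀ ℚ-ring

  ℕ→ℚ-nonNeg : ∀ m → 0ℚ ≤ ℕ→ℚ m
  ℕ→ℚ-nonNeg m = nonNegative⁻¹ (ℕ→ℚ m) {{normalize-nonNeg m 1}}

  ℕ→ℚ-positive : ∀ m → Positive (ℕ→ℚ (suc m))
  ℕ→ℚ-positive m = normalize-pos (suc m) 1

  ℕ→ℚ-pos : ∀ m → 0ℚ < ℕ→ℚ (suc m)
  ℕ→ℚ-pos m = positive⁻¹ (ℕ→ℚ (suc m)) {{ℕ→ℚ-positive m}}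

  recip : ℕ → ℚ
  recip n = 1/_ (ℕ→ℚ (suc n)) {{pos⇒nonZero (ℕ→ℚ (suc n)) {{ℕ→ℚ-positive n}}}}

  recip-inverse : ∀ n → ℕ→ℚ (suc n) * recip n ≡ 1ℚ
  recip-inverse n = *-inverseʳ (ℕ→ℚ (suc n)) {{pos⇒nonZero (ℕ→ℚ (suc n)) {{ℕ→ℚ-positive n}}}}

  recip-pos : ∀ n → 0ℚ < recip n
  recip-pos n = positive⁻¹ (recip n) {{1/pos⇒pos (ℕ→ℚ (suc n)) {{ℕ→ℚ-positive n}}}}

  *-cancel-suc : ∀ n x y → ℕ→ℚ (suc n) * x ≡ ℕ→ℚ (suc n) * y → x ≡ y
  *-cancel-suc n x y e = begin
    x                               ≡⟨ regroup x ⟩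
    recip n * (ℕ→ℚ (suc n) * x)     ≡⟨ cong (recip n *_) e ⟩
    recip n * (ℕ→ℚ (suc n) * y)     ≡⟨ sym (regroup y) ⟩
    y                               ∎
    where
    regroup : ∀ z → z ≡ recip n * (ℕ→ℚ (suc n) * z)
    regroup z = begin
      z                               ≡⟨ sym (*-identityˡ z) ⟩
      1ℚ * z                          ≡⟨ cong (_* z) (sym (recip-inverse n)) ⟩
      (ℕ→ℚ (suc n) * recip n) * z     ≡⟨ swap (ℕ→ℚ (suc n)) (recip n) z ⟩
      recip n * (ℕ→ℚ (suc n) * z)     ∎
      where
      swap : ∀ a r w → (a * r) * w ≡ r * (a * w)
      swap = solve-∀ ℚ-ring

open Embedding

module PowerSeries where
  open ≡-Reasoning

  Series : Set
  Series = ℕ → ℚ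

  infix 4 _≋_
  _≋_ : Series → Series → Set
  a ≋ b = ∀ n → a n ≡ b n

  ≋-sym : ∀ {a b} → a ≋ b → b ≋ a
  ≋-sym e n = sym (e n)

  -- tail a = (a − a₀)/x and shift a = x·a
  tail : Series → Series
  tail a n = a (suc n)

  shift : Series → Series
  shift a zero = 0ℚ
  shift a (suc n) = a n

  𝟙 : Series
  𝟙 zero = 1ℚ
  𝟙 (suc n) = 0ℚ

  𝟘 : Series
  𝟘 _ = 0ℚ

  𝕏 : Series
  𝕏 = shift 𝟙

  infixl 6 _⊕_ _⊖_
  infixl 7 _·_ _⋆_

  _⊕_ : Series → Series → Series
  (a ⊕ b) n = a n + b n

  _⊖_ : Series → Series → Series
  (a ⊖ b) n = a n - b n

  _·_ : ℚ → Series → Series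
  (c · a) n = c * a n

  -- (a ⋆ b)ₙ = Σ_{i ≤ n} aᵢ b_{n−i}, computed by peeling off a₀
  _⋆_ : Series → Series → Series
  (a ⋆ b) zero = a 0 * b 0
  (a ⋆ b) (suc n) = a 0 * b (suc n) + (tail a ⋆ b) n

  shift-cong : ∀ {a b} → a ≋ b → shift a ≋ shift b
  shift-cong e zero = refl
  shift-cong e (suc n) = e n

  ⋆-congˡ : ∀ {a a′} b → a ≋ a′ → a ⋆ b ≋ a′ ⋆ b
  ⋆-congˡ b e zero = cong (_* b 0) (e 0)
  ⋆-congˡ b e (suc n) = cong₂ _+_ (cong (_* b (suc n)) (e 0)) (⋆-congˡ b (λ m → e (suc m)) n)

  ⋆-congʳ : ∀ a {b b′} → b ≋ b′ → a ⋆ b ≋ a ⋆ b′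
  ⋆-congʳ a e zero = cong (a 0 *_) (e 0)
  ⋆-congʳ a e (suc n) = cong₂ _+_ (cong (a 0 *_) (e (suc n))) (⋆-congʳ (tail a) e n)

  ⋆-cong : ∀ {a a′ b b′} → a ≋ a′ → b ≋ b′ → a ⋆ b ≋ a′ ⋆ b′
  ⋆-cong {a′ = a′} {b = b} e f n = trans (⋆-congˡ b e n) (⋆-congʳ a′ f n)

  ⋆-local : ∀ n a a′ b b′ → (∀ m → m ℕ.≤ n → a m ≡ a′ m) → (∀ m → m ℕ.≤ n → b m ≡ b′ m) →
            (a ⋆ b) n ≡ (a′ ⋆ b′) n
  ⋆-local zero a a′ b b′ ea eb = cong₂ _*_ (ea 0 z≤n) (eb 0 z≤n)
  ⋆-local (suc n) a a′ b b′ ea eb =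
    cong₂ _+_ (cong₂ _*_ (ea 0 z≤n) (eb (suc n) ℕP.≤-refl))
              (⋆-local n (tail a) (tail a′) b b′ (λ m m≤n → ea (suc m) (s≤s m≤n))
                                                  (λ m m≤n → eb m (ℕP.m≤n⇒m≤1+n m≤n)))

  ⋆-zeroˡ : ∀ b → 𝟘 ⋆ b ≋ 𝟘
  ⋆-zeroˡ b zero = *-zeroˡ (b 0)
  ⋆-zeroˡ b (suc n) = trans (cong₂ _+_ (*-zeroˡ (b (suc n))) (⋆-zeroˡ b n)) (+-identityˡ 0ℚ)

  ⋆-identityˡ : ∀ b → 𝟙 ⋆ b ≋ b
  ⋆-identityˡ b zero = *-identityˡ (b 0)
  ⋆-identityˡ b (suc n) = trans (cong₂ _+_ (*-identityˡ (b (suc n))) (⋆-zeroˡ b n)) (+-identityʳ (b (suc n)))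

  ⋆-distribʳ-⊕ : ∀ a b c → (a ⊕ b) ⋆ c ≋ a ⋆ c ⊕ b ⋆ c
  ⋆-distribʳ-⊕ a b c zero = *-distribʳ-+ (c 0) (a 0) (b 0)
  ⋆-distribʳ-⊕ a b c (suc n) =
    trans (cong ((a 0 + b 0) * c (suc n) +_) (⋆-distribʳ-⊕ (tail a) (tail b) c n))
          (regroup (a 0) (b 0) (c (suc n)) ((tail a ⋆ c) n) ((tail b ⋆ c) n))
    where
    regroup : ∀ x y z u v → (x + y) * z + (u + v) ≡ (x * z + u) + (y * z + v)
    regroup = solve-∀ ℚ-ring

  ⋆-distribʳ-⊖ : ∀ a b c → (a ⊖ b) ⋆ c ≋ a ⋆ c ⊖ b ⋆ c
  ⋆-distribʳ-⊖ a b c zero = regroup₀ (a 0) (b 0) (c 0)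
    where
    regroup₀ : ∀ x y z → (x - y) * z ≡ x * z - y * z
    regroup₀ = solve-∀ ℚ-ring
  ⋆-distribʳ-⊖ a b c (suc n) =
    trans (cong ((a 0 - b 0) * c (suc n) +_) (⋆-distribʳ-⊖ (tail a) (tail b) c n))
          (regroup (a 0) (b 0) (c (suc n)) ((tail a ⋆ c) n) ((tail b ⋆ c) n))
    where
    regroup : ∀ x y z u v → (x - y) * z + (u - v) ≡ (x * z + u) - (y * z + v)
    regroup = solve-∀ ℚ-ring

  ⋆-scaleˡ : ∀ k a b → (k · a) ⋆ b ≋ k · (a ⋆ b)
  ⋆-scaleˡ k a b zero = *-assoc k (a 0) (b 0)
  ⋆-scaleˡ k a b (suc n) =
    trans (cong (k * a 0 * b (suc n) +_) (⋆-scaleˡ k (tail a) b n))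
          (regroup k (a 0) (b (suc n)) ((tail a ⋆ b) n))
    where
    regroup : ∀ k x y u → k * x * y + k * u ≡ k * (x * y + u)
    regroup = solve-∀ ℚ-ring

  ⋆-shiftˡ : ∀ a b → shift a ⋆ b ≋ shift (a ⋆ b)
  ⋆-shiftˡ a b zero = *-zeroˡ (b 0)
  ⋆-shiftˡ a b (suc n) = trans (cong (_+ (a ⋆ b) n) (*-zeroˡ (b (suc n)))) (+-identityˡ ((a ⋆ b) n))

  ⋆-unfold : ∀ a b → a ⋆ b ≋ (a 0 · b) ⊕ shift (tail a ⋆ b)
  ⋆-unfold a b zero = sym (+-identityʳ (a 0 * b 0))
  ⋆-unfold a b (suc n) = refl

  ⋆-comm : ∀ a b → a ⋆ b ≋ b ⋆ a
  ⋆-comm a b zero = *-comm (a 0) (b 0)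
  ⋆-comm a b (suc zero) = swap (a 0) (b 1) (a 1) (b 0)
    where
    swap : ∀ x y z w → x * y + z * w ≡ w * z + y * x
    swap = solve-∀ ℚ-ring
  ⋆-comm a b (suc (suc n)) = begin
    a 0 * b (2 ℕ.+ n) + (tail a ⋆ b) (suc n)
      ≡⟨ cong (a 0 * b (2 ℕ.+ n) +_) (⋆-comm (tail a) b (suc n)) ⟩
    a 0 * b (2 ℕ.+ n) + (b 0 * a (2 ℕ.+ n) + (tail b ⋆ tail a) n)
      ≡⟨ cong (λ z → a 0 * b (2 ℕ.+ n) + (b 0 * a (2 ℕ.+ n) + z)) (⋆-comm (tail b) (tail a) n) ⟩
    a 0 * b (2 ℕ.+ n) + (b 0 * a (2 ℕ.+ n) + (tail a ⋆ tail b) n)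
      ≡⟨ swap (a 0 * b (2 ℕ.+ n)) (b 0 * a (2 ℕ.+ n)) ((tail a ⋆ tail b) n) ⟩
    b 0 * a (2 ℕ.+ n) + (a 0 * b (2 ℕ.+ n) + (tail a ⋆ tail b) n)
      ≡⟨ cong (b 0 * a (2 ℕ.+ n) +_) (⋆-comm a (tail b) (suc n)) ⟩
    b 0 * a (2 ℕ.+ n) + (tail b ⋆ a) (suc n) ∎
    where
    swap : ∀ x y z → x + (y + z) ≡ y + (x + z)
    swap = solve-∀ ℚ-ring

  ⋆-assoc : ∀ a b c → (a ⋆ b) ⋆ c ≋ a ⋆ (b ⋆ c)
  ⋆-assoc a b c zero = *-assoc (a 0) (b 0) (c 0)
  ⋆-assoc a b c (suc m) = begin
    (a 0 * b 0) * c (suc m) + (((a 0 · tail b) ⊕ (tail a ⋆ b)) ⋆ c) m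
      ≡⟨ cong ((a 0 * b 0) * c (suc m) +_) (⋆-distribʳ-⊕ (a 0 · tail b) (tail a ⋆ b) c m) ⟩
    (a 0 * b 0) * c (suc m) + (((a 0 · tail b) ⋆ c) m + ((tail a ⋆ b) ⋆ c) m)
      ≡⟨ cong₂ (λ u v → (a 0 * b 0) * c (suc m) + (u + v)) (⋆-scaleˡ (a 0) (tail b) c m) (⋆-assoc (tail a) b c m) ⟩
    (a 0 * b 0) * c (suc m) + (a 0 * (tail b ⋆ c) m + (tail a ⋆ (b ⋆ c)) m)
      ≡⟨ regroup (a 0) (b 0) (c (suc m)) ((tail b ⋆ c) m) ((tail a ⋆ (b ⋆ c)) m) ⟩
    a 0 * (b 0 * c (suc m) + (tail b ⋆ c) m) + (tail a ⋆ (b ⋆ c)) m ∎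
    where
    regroup : ∀ x y z u v → (x * y) * z + (x * u + v) ≡ x * (y * z + u) + v
    regroup = solve-∀ ℚ-ring

  ⋆-zeroʳ : ∀ a → a ⋆ 𝟘 ≋ 𝟘
  ⋆-zeroʳ a n = trans (⋆-comm a 𝟘 n) (⋆-zeroˡ a n)

  ⋆-identityʳ : ∀ a → a ⋆ 𝟙 ≋ a
  ⋆-identityʳ a n = trans (⋆-comm a 𝟙 n) (⋆-identityˡ a n)

  ⋆-distribˡ-⊕ : ∀ a b c → a ⋆ (b ⊕ c) ≋ a ⋆ b ⊕ a ⋆ c
  ⋆-distribˡ-⊕ a b c n = trans (⋆-comm a (b ⊕ c) n)
    (trans (⋆-distribʳ-⊕ b c a n) (cong₂ _+_ (⋆-comm b a n) (⋆-comm c a n)))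

  ⋆-distribˡ-⊖ : ∀ a b c → a ⋆ (b ⊖ c) ≋ a ⋆ b ⊖ a ⋆ c
  ⋆-distribˡ-⊖ a b c n = trans (⋆-comm a (b ⊖ c) n)
    (trans (⋆-distribʳ-⊖ b c a n) (cong₂ _-_ (⋆-comm b a n) (⋆-comm c a n)))

  ⋆-scaleʳ : ∀ k a b → a ⋆ (k · b) ≋ k · (a ⋆ b)
  ⋆-scaleʳ k a b n = trans (⋆-comm a (k · b) n) (trans (⋆-scaleˡ k b a n) (cong (k *_) (⋆-comm b a n)))

  ⋆-shiftʳ : ∀ a b → a ⋆ shift b ≋ shift (a ⋆ b)
  ⋆-shiftʳ a b n = trans (⋆-comm a (shift b) n) (trans (⋆-shiftˡ b a n) (shift-cong (⋆-comm b a) n))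

  ⋆-𝕏ˡ : ∀ a → 𝕏 ⋆ a ≋ shift a
  ⋆-𝕏ˡ a n = trans (⋆-shiftˡ 𝟙 a n) (shift-cong (⋆-identityˡ a) n)
open PowerSeries

module Derivative where
  open ≡-Reasoning

  D : Series → Series
  D a n = ℕ→ℚ (suc n) * a (suc n)

  D-cong : ∀ {a b} → a ≋ b → D a ≋ D b
  D-cong e n = cong (ℕ→ℚ (suc n) *_) (e (suc n))

  D-⊕ : ∀ a b → D (a ⊕ b) ≋ D a ⊕ D b
  D-⊕ a b n = *-distribˡ-+ (ℕ→ℚ (suc n)) (a (suc n)) (b (suc n))

  D-⊖ : ∀ a b → D (a ⊖ b) ≋ D a ⊖ D b
  D-⊖ a b n = distrib (ℕ→ℚ (suc n)) (a (suc n)) (b (suc n))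
    where
    distrib : ∀ x y z → x * (y - z) ≡ x * y - x * z
    distrib = solve-∀ ℚ-ring

  D-· : ∀ k a → D (k · a) ≋ k · D a
  D-· k a n = swap (ℕ→ℚ (suc n)) k (a (suc n))
    where
    swap : ∀ x y z → x * (y * z) ≡ y * (x * z)
    swap = solve-∀ ℚ-ring

  D-𝟙 : D 𝟙 ≋ 𝟘
  D-𝟙 n = *-zeroʳ (ℕ→ℚ (suc n))

  D-𝕏 : D 𝕏 ≋ 𝟙
  D-𝕏 zero = refl
  D-𝕏 (suc n) = *-zeroʳ (ℕ→ℚ (suc (suc n)))

  D-shift : ∀ a → D (shift a) ≋ a ⊕ shift (D a)
  D-shift a zero = trans (*-identityˡ (a 0)) (sym (+-identityʳ (a 0)))
  D-shift a (suc n) = trans (cong (_* a (suc n)) (ℕ→ℚ-suc (suc n))) (distrib (ℕ→ℚ (suc n)) (a (suc n)))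
    where
    distrib : ∀ x y → (1ℚ + x) * y ≡ y + x * y
    distrib = solve-∀ ℚ-ring

  D-unfold : ∀ a → D a ≋ tail a ⊕ shift (D (tail a))
  D-unfold a n = D-shift (tail a) n

  leibniz-step : ∀ a b n →
    shift (D (tail a ⋆ b)) n ≡ shift (D (tail a) ⋆ b ⊕ tail a ⋆ D b) n →
    D (a ⋆ b) n ≡ (D a ⋆ b ⊕ a ⋆ D b) n
  leibniz-step a b n hyp = begin
    D (a ⋆ b) n
      ≡⟨ D-cong (⋆-unfold a b) n ⟩
    D ((a 0 · b) ⊕ shift (tail a ⋆ b)) n
      ≡⟨ D-⊕ (a 0 · b) (shift (tail a ⋆ b)) n ⟩
    D (a 0 · b) n + D (shift (tail a ⋆ b)) n
      ≡⟨ cong₂ _+_ (D-· (a 0) b n) (D-shift (tail a ⋆ b) n) ⟩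
    a 0 * D b n + ((tail a ⋆ b) n + shift (D (tail a ⋆ b)) n)
      ≡⟨ cong (λ z → a 0 * D b n + ((tail a ⋆ b) n + z)) hyp ⟩
    a 0 * D b n + ((tail a ⋆ b) n + shift (D (tail a) ⋆ b ⊕ tail a ⋆ D b) n)
      ≡⟨ regroup n ⟩
    ((tail a ⋆ b) n + shift (D (tail a) ⋆ b) n) + (a 0 * D b n + shift (tail a ⋆ D b) n)
      ≡⟨ cong₂ _+_ (sym Da⋆b) (sym (⋆-unfold a (D b) n)) ⟩
    (D a ⋆ b) n + (a ⋆ D b) n ∎
    where
    Da⋆b : (D a ⋆ b) n ≡ (tail a ⋆ b) n + shift (D (tail a) ⋆ b) n
    Da⋆b = trans (⋆-congˡ b (D-unfold a) n)
             (trans (⋆-distribʳ-⊕ (tail a) (shift (D (tail a))) b n)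
                    (cong ((tail a ⋆ b) n +_) (⋆-shiftˡ (D (tail a)) b n)))
    regroup : ∀ n → a 0 * D b n + ((tail a ⋆ b) n + shift (D (tail a) ⋆ b ⊕ tail a ⋆ D b) n)
                  ≡ ((tail a ⋆ b) n + shift (D (tail a) ⋆ b) n) + (a 0 * D b n + shift (tail a ⋆ D b) n)
    regroup zero = ring₀ (a 0 * D b 0) ((tail a ⋆ b) 0)
      where
      ring₀ : ∀ x y → x + (y + 0ℚ) ≡ (y + 0ℚ) + (x + 0ℚ)
      ring₀ = solve-∀ ℚ-ring
    regroup (suc m) = ring₊ (a 0 * D b (suc m)) ((tail a ⋆ b) (suc m)) ((D (tail a) ⋆ b) m) ((tail a ⋆ D b) m)
      where
      ring₊ : ∀ x y u v → x + (y + (u + v)) ≡ (y + u) + (x + v)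
      ring₊ = solve-∀ ℚ-ring

  leibniz : ∀ a b → D (a ⋆ b) ≋ D a ⋆ b ⊕ a ⋆ D b
  leibniz a b zero = leibniz-step a b zero refl
  leibniz a b (suc m) = leibniz-step a b (suc m) (leibniz (tail a) b m)
open Derivative

-- The exponential series exp c = Σ cⁿ xⁿ/n!, characterised by the linear
-- differential equation h′ = c·h, which yields exp a ⋆ exp b = exp (a + b).
module Exponential where
  open ≡-Reasoning

  pow : ℚ → ℕ → ℚ
  pow c zero = 1ℚ
  pow c (suc n) = c * pow c n

  invfact : ℕ → ℚ
  invfact zero = 1ℚ
  invfact (suc n) = invfact n * recip n

  invfact-step : ∀ n → ℕ→ℚ (suc n) * invfact (suc n) ≡ invfact n
  invfact-step n = begin
    ℕ→ℚ (suc n) * (invfact n * recip n) ≡⟨ swap (ℕ→ℚ (suc n)) (invfact n) (recip n) ⟩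
    invfact n * (ℕ→ℚ (suc n) * recip n) ≡⟨ cong (invfact n *_) (recip-inverse n) ⟩
    invfact n * 1ℚ                      ≡⟨ *-identityʳ (invfact n) ⟩
    invfact n                           ∎
    where
    swap : ∀ a b c → a * (b * c) ≡ b * (a * c)
    swap = solve-∀ ℚ-ring

  exp : ℚ → Series
  exp c n = pow c n * invfact n

  D-exp : ∀ c → D (exp c) ≋ c · exp c
  D-exp c n = begin
    ℕ→ℚ (suc n) * (c * pow c n * invfact (suc n))   ≡⟨ swap (ℕ→ℚ (suc n)) c (pow c n) (invfact (suc n)) ⟩
    c * pow c n * (ℕ→ℚ (suc n) * invfact (suc n))   ≡⟨ cong (c * pow c n *_) (invfact-step n) ⟩
    c * pow c n * invfact n                         ≡⟨ *-assoc c (pow c n) (invfact n) ⟩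
    c * (pow c n * invfact n)                       ∎
    where
    swap : ∀ N c p i → N * (c * p * i) ≡ c * p * (N * i)
    swap = solve-∀ ℚ-ring

  linear-ode-unique : ∀ c h → D h ≋ c · h → h ≋ h 0 · exp c
  linear-ode-unique c h h′ zero = sym (*-identityʳ (h 0))
  linear-ode-unique c h h′ (suc n) = *-cancel-suc n (h (suc n)) (h 0 * exp c (suc n)) (begin
    ℕ→ℚ (suc n) * h (suc n)              ≡⟨ h′ n ⟩
    c * h n                              ≡⟨ cong (c *_) (linear-ode-unique c h h′ n) ⟩
    c * (h 0 * exp c n)                  ≡⟨ swap c (h 0) (exp c n) ⟩
    h 0 * (c * exp c n)                  ≡⟨ cong (h 0 *_) (sym (D-exp c n)) ⟩
    h 0 * (ℕ→ℚ (suc n) * exp c (suc n))  ≡⟨ swap (h 0) (ℕ→ℚ (suc n)) (exp c (suc n)) ⟩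
    ℕ→ℚ (suc n) * (h 0 * exp c (suc n))  ∎)
    where
    swap : ∀ x y z → x * (y * z) ≡ y * (x * z)
    swap = solve-∀ ℚ-ring

  exp-+ : ∀ a b → exp a ⋆ exp b ≋ exp (a + b)
  exp-+ a b n = trans (linear-ode-unique (a + b) h h′ n) (*-identityˡ (exp (a + b) n))
    where
    h : Series
    h = exp a ⋆ exp b
    h′ : D h ≋ (a + b) · h
    h′ m = begin
      D h m                                  ≡⟨ leibniz (exp a) (exp b) m ⟩
      (D (exp a) ⋆ exp b) m + (exp a ⋆ D (exp b)) m
        ≡⟨ cong₂ _+_ (⋆-congˡ (exp b) (D-exp a) m) (⋆-congʳ (exp a) (D-exp b) m) ⟩
      ((a · exp a) ⋆ exp b) m + (exp a ⋆ (b · exp b)) m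
        ≡⟨ cong₂ _+_ (⋆-scaleˡ a (exp a) (exp b) m) (⋆-scaleʳ b (exp a) (exp b) m) ⟩
      a * h m + b * h m                      ≡⟨ sym (*-distribʳ-+ (h m) a b) ⟩
      (a + b) * h m                          ∎

  exp-0 : exp 0ℚ ≋ 𝟙
  exp-0 zero = refl
  exp-0 (suc n) = trans (cong (_* invfact (suc n)) (*-zeroˡ (pow 0ℚ n))) (*-zeroˡ (invfact (suc n)))
open Exponential

-- Course-of-values recursion for series: a step function computing the
-- n-th coefficient from the coefficients of index < n has a fixed point,
-- obtained by memoising finite prefixes.
module CourseOfValues (step : ℕ → Series → ℚ)
    (step-local : ∀ n s s′ → (∀ m → m ℕ.< n → s m ≡ s′ m) → step n s ≡ step n s′) where

  -- prefix n holds the correct coefficients of index ≤ n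
  private
    prefix : ℕ → Series
    prefix zero _ = step 0 𝟘
    prefix (suc n) m with m ℕ.≤? n
    ... | yes _ = prefix n m
    ... | no _ = step (suc n) (prefix n)

  fix : Series
  fix n = prefix n n

  private
    prefix-stable : ∀ n m → m ℕ.≤ n → prefix (suc n) m ≡ prefix n m
    prefix-stable n m m≤n with m ℕ.≤? n
    ... | yes _ = refl
    ... | no m≰n = contradiction m≤n m≰n

    prefix-fix′ : ∀ d m → prefix (d ℕ.+ m) m ≡ fix m
    prefix-fix′ zero m = refl
    prefix-fix′ (suc d) m = trans (prefix-stable (d ℕ.+ m) m (ℕP.m≤n+m m d)) (prefix-fix′ d m)

    prefix-fix : ∀ n m → m ℕ.≤ n → prefix n m ≡ fix m
    prefix-fix n m m≤n = trans (cong (λ z → prefix z m) (sym (ℕP.m∸n+n≡m m≤n))) (prefix-fix′ (n ℕ.∸ m) m)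

  fix-eq : ∀ n → fix n ≡ step n fix
  fix-eq zero = step-local 0 𝟘 fix (λ m ())
  fix-eq (suc n) with suc n ℕ.≤? n
  ... | yes n<n = contradiction n<n (ℕP.n≮n n)
  ... | no _ = step-local (suc n) (prefix n) fix (λ m m<sn → prefix-fix n m (ℕP.≤-pred m<sn))

-- The Bernoulli series β = x/(eˣ − 1), whose coefficients are Bₙ/n!.  It is
-- defined as the inverse of U = (eˣ − 1)/x, and Faulhaber's formula
-- β ⋆ (eⁿˣ − 1) = x·Σ_{m<n} e^{mx} expresses power sums through it.
module Bernoulli where
  open ≡-Reasoning

  -- U = (eˣ − 1)/x and eˣ − 1 = x·U
  U : Series
  U = tail (exp 1ℚ)

  expm1 : Series
  expm1 = exp 1ℚ ⊖ 𝟙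

  shift-U : shift U ≋ expm1
  shift-U zero = refl
  shift-U (suc n) = sym (+-identityʳ (exp 1ℚ (suc n)))

  -- U₀ = 1, so U ⋆ β = 1 determines β recursively
  private
    β-step : ℕ → Series → ℚ
    β-step zero _ = 1ℚ
    β-step (suc n) s = - (tail U ⋆ s) n

    β-step-local : ∀ n s s′ → (∀ m → m ℕ.< n → s m ≡ s′ m) → β-step n s ≡ β-step n s′
    β-step-local zero s s′ e = refl
    β-step-local (suc n) s s′ e =
      cong -_ (⋆-local n (tail U) (tail U) s s′ (λ _ _ → refl) (λ m m≤n → e m (s≤s m≤n)))

    module β-recursion = CourseOfValues β-step β-step-local

  opaque
    β : Series
    β = β-recursion.fix

    β-0 : β 0 ≡ 1ℚ
    β-0 = β-recursion.fix-eq 0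

    β-rec : ∀ n → β (suc n) ≡ - (tail U ⋆ β) n
    β-rec n = β-recursion.fix-eq (suc n)

  U⋆β : U ⋆ β ≋ 𝟙
  U⋆β zero = trans (*-identityˡ (β 0)) β-0
  U⋆β (suc n) = begin
    1ℚ * β (suc n) + (tail U ⋆ β) n          ≡⟨ cong (λ z → 1ℚ * z + (tail U ⋆ β) n) (β-rec n) ⟩
    1ℚ * (- (tail U ⋆ β) n) + (tail U ⋆ β) n ≡⟨ cancel ((tail U ⋆ β) n) ⟩
    0ℚ                                       ∎
    where
    cancel : ∀ x → 1ℚ * (- x) + x ≡ 0ℚ
    cancel = solve-∀ ℚ-ring

  β⋆expm1 : β ⋆ expm1 ≋ 𝕏
  β⋆expm1 n = begin
    (β ⋆ expm1) n       ≡⟨ ⋆-congʳ β (≋-sym shift-U) n ⟩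
    (β ⋆ shift U) n     ≡⟨ ⋆-shiftʳ β U n ⟩
    shift (β ⋆ U) n     ≡⟨ shift-cong (λ m → trans (⋆-comm β U m) (U⋆β m)) n ⟩
    𝕏 n                 ∎

  expm1⋆β : expm1 ⋆ β ≋ 𝕏
  expm1⋆β n = trans (⋆-comm expm1 β n) (β⋆expm1 n)

  -- eˣ − 1 is not a zero divisor: multiply by β to get x·a = 0
  expm1-cancel : ∀ a → expm1 ⋆ a ≋ 𝟘 → a ≋ 𝟘
  expm1-cancel a e n = begin
    a n                              ≡⟨ sym (⋆-𝕏ˡ a (suc n)) ⟩
    (𝕏 ⋆ a) (suc n)                  ≡⟨ ⋆-congˡ a (≋-sym β⋆expm1) (suc n) ⟩
    ((β ⋆ expm1) ⋆ a) (suc n)        ≡⟨ ⋆-assoc β expm1 a (suc n) ⟩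
    (β ⋆ (expm1 ⋆ a)) (suc n)        ≡⟨ ⋆-congʳ β e (suc n) ⟩
    (β ⋆ 𝟘) (suc n)                  ≡⟨ ⋆-zeroʳ β (suc n) ⟩
    0ℚ                               ∎

  -- Σ_{m<n} e^{mx}, whose k-th coefficient is (Σ_{m<n} mᵏ)/k!
  powerSums : ℕ → Series
  powerSums zero = 𝟘
  powerSums (suc n) = powerSums n ⊕ exp (ℕ→ℚ n)

  expm1⋆exp : ∀ c → expm1 ⋆ exp c ≋ exp (1ℚ + c) ⊖ exp c
  expm1⋆exp c n = begin
    (expm1 ⋆ exp c) n                         ≡⟨ ⋆-distribʳ-⊖ (exp 1ℚ) 𝟙 (exp c) n ⟩
    (exp 1ℚ ⋆ exp c) n - (𝟙 ⋆ exp c) n         ≡⟨ cong₂ _-_ (exp-+ 1ℚ c n) (⋆-identityˡ (exp c) n) ⟩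
    exp (1ℚ + c) n - exp c n                  ∎

  -- the power sums telescope against eˣ − 1
  expm1⋆powerSums : ∀ n → expm1 ⋆ powerSums n ≋ exp (ℕ→ℚ n) ⊖ 𝟙
  expm1⋆powerSums zero m = trans (⋆-zeroʳ expm1 m) (sym (trans (cong (_- 𝟙 m) (exp-0 m)) (+-inverseʳ (𝟙 m))))
  expm1⋆powerSums (suc n) m = begin
    (expm1 ⋆ (powerSums n ⊕ exp N)) m             ≡⟨ ⋆-distribˡ-⊕ expm1 (powerSums n) (exp N) m ⟩
    (expm1 ⋆ powerSums n) m + (expm1 ⋆ exp N) m   ≡⟨ cong₂ _+_ (expm1⋆powerSums n m) (expm1⋆exp N m) ⟩
    (exp N m - 𝟙 m) + (exp (1ℚ + N) m - exp N m)  ≡⟨ telescope (exp N m) (𝟙 m) (exp (1ℚ + N) m) ⟩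
    exp (1ℚ + N) m - 𝟙 m                          ≡⟨ cong (λ z → exp z m - 𝟙 m) (sym (ℕ→ℚ-suc n)) ⟩
    exp (ℕ→ℚ (suc n)) m - 𝟙 m                     ∎
    where
    N = ℕ→ℚ n
    telescope : ∀ a d b → (a - d) + (b - a) ≡ b - d
    telescope = solve-∀ ℚ-ring

  faulhaber : ∀ n → β ⋆ (exp (ℕ→ℚ n) ⊖ 𝟙) ≋ shift (powerSums n)
  faulhaber n m = begin
    (β ⋆ (exp (ℕ→ℚ n) ⊖ 𝟙)) m     ≡⟨ ⋆-congʳ β (≋-sym (expm1⋆powerSums n)) m ⟩
    (β ⋆ (expm1 ⋆ powerSums n)) m ≡⟨ sym (⋆-assoc β expm1 (powerSums n) m) ⟩
    ((β ⋆ expm1) ⋆ powerSums n) m ≡⟨ ⋆-congˡ (powerSums n) β⋆expm1 m ⟩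
    (𝕏 ⋆ powerSums n) m           ≡⟨ ⋆-𝕏ˡ (powerSums n) m ⟩
    shift (powerSums n) m         ∎
open Bernoulli

-- The Riccati equation x·a′ + x·a + a² − a = 0.  The Bernoulli series
-- satisfies it, and it has only one solution with constant term 1.
module Riccati where
  open ≡-Reasoning

  Riccati : Series → Series
  Riccati a = shift (D a) ⊕ shift a ⊕ a ⋆ a ⊖ a

  D-expm1 : D expm1 ≋ expm1 ⊕ 𝟙
  D-expm1 n = begin
    D (exp 1ℚ ⊖ 𝟙) n          ≡⟨ D-⊖ (exp 1ℚ) 𝟙 n ⟩
    D (exp 1ℚ) n - D 𝟙 n      ≡⟨ cong₂ _-_ (trans (D-exp 1ℚ n) (*-identityˡ (exp 1ℚ n))) (D-𝟙 n) ⟩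
    exp 1ℚ n - 0ℚ             ≡⟨ regroup (exp 1ℚ n) (𝟙 n) ⟩
    (exp 1ℚ n - 𝟙 n) + 𝟙 n    ∎
    where
    regroup : ∀ x y → x - 0ℚ ≡ (x - y) + y
    regroup = solve-∀ ℚ-ring

  -- differentiating β·(eˣ − 1) = x gives β′·(eˣ − 1) + x + β = 1
  β-derivative : ∀ n → (D β ⋆ expm1) n + (𝕏 n + β n) ≡ 𝟙 n
  β-derivative n = begin
    (D β ⋆ expm1) n + (𝕏 n + β n)
      ≡⟨ cong ((D β ⋆ expm1) n +_) (cong₂ _+_ (sym (β⋆expm1 n)) (sym (⋆-identityʳ β n))) ⟩
    (D β ⋆ expm1) n + ((β ⋆ expm1) n + (β ⋆ 𝟙) n)
      ≡⟨ cong ((D β ⋆ expm1) n +_) (sym (trans (⋆-congʳ β D-expm1 n) (⋆-distribˡ-⊕ β expm1 𝟙 n))) ⟩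
    (D β ⋆ expm1) n + (β ⋆ D expm1) n
      ≡⟨ sym (leibniz β expm1 n) ⟩
    D (β ⋆ expm1) n
      ≡⟨ trans (D-cong β⋆expm1 n) (D-𝕏 n) ⟩
    𝟙 n ∎

  expm1⋆Riccati-β : expm1 ⋆ Riccati β ≋ 𝟘
  expm1⋆Riccati-β n = begin
    (expm1 ⋆ Riccati β) n
      ≡⟨ ⋆-distribˡ-⊖ expm1 (shift (D β) ⊕ shift β ⊕ β ⋆ β) β n ⟩
    (expm1 ⋆ (shift (D β) ⊕ shift β ⊕ β ⋆ β)) n - (expm1 ⋆ β) n
      ≡⟨ cong (_- (expm1 ⋆ β) n) (trans (⋆-distribˡ-⊕ expm1 (shift (D β) ⊕ shift β) (β ⋆ β) n)
                (cong (_+ (expm1 ⋆ (β ⋆ β)) n) (⋆-distribˡ-⊕ expm1 (shift (D β)) (shift β) n))) ⟩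
    ((expm1 ⋆ shift (D β)) n + (expm1 ⋆ shift β) n) + (expm1 ⋆ (β ⋆ β)) n - (expm1 ⋆ β) n
      ≡⟨ cong₂ (λ x y → (x + y) + (expm1 ⋆ (β ⋆ β)) n - (expm1 ⋆ β) n) x·β′ x·β ⟩
    (shift (D β ⋆ expm1) n + shift 𝕏 n) + (expm1 ⋆ (β ⋆ β)) n - (expm1 ⋆ β) n
      ≡⟨ cong₂ (λ x y → (shift (D β ⋆ expm1) n + shift 𝕏 n) + x - y) β² (expm1⋆β n) ⟩
    (shift (D β ⋆ expm1) n + shift 𝕏 n) + shift β n - 𝕏 n
      ≡⟨ vanish n ⟩
    0ℚ ∎
    where
    x·β′ : (expm1 ⋆ shift (D β)) n ≡ shift (D β ⋆ expm1) n
    x·β′ = trans (⋆-shiftʳ expm1 (D β) n) (shift-cong (⋆-comm expm1 (D β)) n)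
    x·β : (expm1 ⋆ shift β) n ≡ shift 𝕏 n
    x·β = trans (⋆-shiftʳ expm1 β n) (shift-cong expm1⋆β n)
    β² : (expm1 ⋆ (β ⋆ β)) n ≡ shift β n
    β² = trans (sym (⋆-assoc expm1 β β n)) (trans (⋆-congˡ β expm1⋆β n) (⋆-𝕏ˡ β n))
    vanish : ∀ n → (shift (D β ⋆ expm1) n + shift 𝕏 n) + shift β n - 𝕏 n ≡ 0ℚ
    vanish zero = refl
    vanish (suc m) = trans (regroup ((D β ⋆ expm1) m) (𝕏 m) (β m) (𝟙 m))
                           (trans (cong (_- 𝟙 m) (β-derivative m)) (+-inverseʳ (𝟙 m)))
      where
      regroup : ∀ a b c d → (a + b) + c - d ≡ (a + (b + c)) - d
      regroup = solve-∀ ℚ-ring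

  β-Riccati : Riccati β ≋ 𝟘
  β-Riccati = expm1-cancel (Riccati β) expm1⋆Riccati-β

  -- For a₀ = 1 the (m+1)-st coefficient of the Riccati expression is
  -- (m+2)·a_{m+1} plus terms involving only a₀,…,a_m.
  Riccati-coeff : ∀ a → a 0 ≡ 1ℚ → ∀ m →
    Riccati a (suc m) ≡ ℕ→ℚ (suc (suc m)) * a (suc m) + (a m + shift (tail a ⋆ tail a) m)
  Riccati-coeff a a₀ m = begin
    ((ℕ→ℚ (suc m) * a (suc m) + a m) + (a 0 * a (suc m) + (tail a ⋆ a) m)) - a (suc m)
      ≡⟨ cong (λ z → ((ℕ→ℚ (suc m) * a (suc m) + a m) + (a 0 * a (suc m) + z)) - a (suc m))
              (trans (⋆-comm (tail a) a m) (⋆-unfold a (tail a) m)) ⟩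
    ((ℕ→ℚ (suc m) * a (suc m) + a m) + (a 0 * a (suc m) + (a 0 * a (suc m) + S))) - a (suc m)
      ≡⟨ cong (λ z → ((ℕ→ℚ (suc m) * a (suc m) + a m) + (z * a (suc m) + (z * a (suc m) + S))) - a (suc m)) a₀ ⟩
    ((ℕ→ℚ (suc m) * a (suc m) + a m) + (1ℚ * a (suc m) + (1ℚ * a (suc m) + S))) - a (suc m)
      ≡⟨ regroup (ℕ→ℚ (suc m)) (a (suc m)) (a m) S ⟩
    (1ℚ + ℕ→ℚ (suc m)) * a (suc m) + (a m + S)
      ≡⟨ cong (λ z → z * a (suc m) + (a m + S)) (sym (ℕ→ℚ-suc (suc m))) ⟩
    ℕ→ℚ (suc (suc m)) * a (suc m) + (a m + S) ∎
    where
    S = shift (tail a ⋆ tail a) m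
    regroup : ∀ N x y s → ((N * x + y) + (1ℚ * x + (1ℚ * x + s))) - x ≡ (1ℚ + N) * x + (y + s)
    regroup = solve-∀ ℚ-ring

  Riccati-unique : ∀ a b → a 0 ≡ 1ℚ → b 0 ≡ 1ℚ → Riccati a ≋ 𝟘 → Riccati b ≋ 𝟘 → a ≋ b
  Riccati-unique a b a₀ b₀ ra rb = <-rec (λ n → a n ≡ b n) agree
    where
    agree : ∀ n → (∀ {m} → m ℕ.< n → a m ≡ b m) → a n ≡ b n
    agree zero _ = trans a₀ (sym b₀)
    agree (suc n) ih = *-cancel-suc (suc n) (a (suc n)) (b (suc n)) (begin
      ℕ→ℚ (suc (suc n)) * a (suc n)   ≡⟨ isolate (ℕ→ℚ (suc (suc n)) * a (suc n)) (lower a) ⟩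
      (ℕ→ℚ (suc (suc n)) * a (suc n) + lower a) - lower a
        ≡⟨ cong₂ _-_ (trans (sym (Riccati-coeff a a₀ n)) (trans (ra (suc n)) (sym (trans (sym (Riccati-coeff b b₀ n)) (rb (suc n))))))
                     lower-agree ⟩
      (ℕ→ℚ (suc (suc n)) * b (suc n) + lower b) - lower b
        ≡⟨ sym (isolate (ℕ→ℚ (suc (suc n)) * b (suc n)) (lower b)) ⟩
      ℕ→ℚ (suc (suc n)) * b (suc n)   ∎)
      where
      lower : Series → ℚ
      lower c = c n + shift (tail c ⋆ tail c) n
      isolate : ∀ x y → x ≡ (x + y) - y
      isolate = solve-∀ ℚ-ring
      shifted-agree : ∀ j → j ℕ.≤ n → shift (tail a ⋆ tail a) j ≡ shift (tail b ⋆ tail b) j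
      shifted-agree zero _ = refl
      shifted-agree (suc k) k<n = ⋆-local k (tail a) (tail b) (tail a) (tail b) same same
        where
        same : ∀ i → i ℕ.≤ k → a (suc i) ≡ b (suc i)
        same i i≤k = ih (s≤s (ℕP.≤-trans (s≤s i≤k) k<n))
      lower-agree : lower a ≡ lower b
      lower-agree = cong₂ _+_ (ih ℕP.≤-refl) (shifted-agree n ℕP.≤-refl)
open Riccati

module Substitution where
  open ≡-Reasoning

  -- atSquare a = a(x²)
  atSquare : Series → Series
  atSquare a zero = a 0
  atSquare a (suc zero) = 0ℚ
  atSquare a (suc (suc n)) = atSquare (tail a) n

  atSquare-cong : ∀ {a b} → a ≋ b → atSquare a ≋ atSquare b
  atSquare-cong e zero = e 0
  atSquare-cong e (suc zero) = refl
  atSquare-cong e (suc (suc n)) = atSquare-cong (λ m → e (suc m)) n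

  atSquare-⊕ : ∀ a b → atSquare (a ⊕ b) ≋ atSquare a ⊕ atSquare b
  atSquare-⊕ a b zero = refl
  atSquare-⊕ a b (suc zero) = refl
  atSquare-⊕ a b (suc (suc n)) = atSquare-⊕ (tail a) (tail b) n

  atSquare-⊖ : ∀ a b → atSquare (a ⊖ b) ≋ atSquare a ⊖ atSquare b
  atSquare-⊖ a b zero = refl
  atSquare-⊖ a b (suc zero) = refl
  atSquare-⊖ a b (suc (suc n)) = atSquare-⊖ (tail a) (tail b) n

  atSquare-· : ∀ k a → atSquare (k · a) ≋ k · atSquare a
  atSquare-· k a zero = refl
  atSquare-· k a (suc zero) = sym (*-zeroʳ k)
  atSquare-· k a (suc (suc n)) = atSquare-· k (tail a) n

  atSquare-𝟘 : ∀ a → a ≋ 𝟘 → atSquare a ≋ 𝟘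
  atSquare-𝟘 a e zero = e 0
  atSquare-𝟘 a e (suc zero) = refl
  atSquare-𝟘 a e (suc (suc n)) = atSquare-𝟘 (tail a) (λ m → e (suc m)) n

  atSquare-even : ∀ a s → atSquare a (s ℕ.+ s) ≡ a s
  atSquare-even a zero = refl
  atSquare-even a (suc s) = trans (cong (λ z → atSquare a (suc z)) (ℕP.+-suc s s)) (atSquare-even (tail a) s)

  atSquare-odd : ∀ a s → atSquare a (suc (s ℕ.+ s)) ≡ 0ℚ
  atSquare-odd a zero = refl
  atSquare-odd a (suc s) = trans (cong (λ z → atSquare a (suc (suc z))) (ℕP.+-suc s s)) (atSquare-odd (tail a) s)

  atSquare-⋆ : ∀ a b → atSquare a ⋆ atSquare b ≋ atSquare (a ⋆ b)
  atSquare-⋆ a b zero = refl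
  atSquare-⋆ a b (suc zero) = vanish (a 0) (b 0)
    where
    vanish : ∀ x y → x * 0ℚ + 0ℚ * y ≡ 0ℚ
    vanish = solve-∀ ℚ-ring
  atSquare-⋆ a b (suc (suc m)) = begin
    a 0 * atSquare (tail b) m + (0ℚ * atSquare b (suc m) + (atSquare (tail a) ⋆ atSquare b) m)
      ≡⟨ cong (λ z → a 0 * atSquare (tail b) m + (0ℚ * atSquare b (suc m) + z)) (atSquare-⋆ (tail a) b m) ⟩
    a 0 * atSquare (tail b) m + (0ℚ * atSquare b (suc m) + atSquare (tail a ⋆ b) m)
      ≡⟨ drop (a 0) (atSquare (tail b) m) (atSquare b (suc m)) (atSquare (tail a ⋆ b) m) ⟩
    a 0 * atSquare (tail b) m + atSquare (tail a ⋆ b) m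
      ≡⟨ sym (trans (atSquare-⊕ (a 0 · tail b) (tail a ⋆ b) m)
                    (cong (_+ atSquare (tail a ⋆ b) m) (atSquare-· (a 0) (tail b) m))) ⟩
    atSquare (a ⋆ b) (suc (suc m)) ∎
    where
    drop : ∀ x y z w → x * y + (0ℚ * z + w) ≡ x * y + w
    drop = solve-∀ ℚ-ring

  shift-D : ∀ a n → shift (D a) n ≡ ℕ→ℚ n * a n
  shift-D a zero = sym (*-zeroˡ (a 0))
  shift-D a (suc n) = refl

  -- x·d/dx (a(x²)) = (2y·da/dy)(x²)
  twiceEuler : Series → Series
  twiceEuler a s = ℕ→ℚ (s ℕ.+ s) * a s

  ℕ→ℚ-2+ : ∀ k y → ℕ→ℚ (2 ℕ.+ k) * y ≡ (1ℚ + 1ℚ) * y + ℕ→ℚ k * y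
  ℕ→ℚ-2+ k y = begin
    ℕ→ℚ (2 ℕ.+ k) * y               ≡⟨ cong (_* y) (trans (ℕ→ℚ-suc (suc k)) (cong (1ℚ +_) (ℕ→ℚ-suc k))) ⟩
    (1ℚ + (1ℚ + ℕ→ℚ k)) * y         ≡⟨ distrib (ℕ→ℚ k) y ⟩
    (1ℚ + 1ℚ) * y + ℕ→ℚ k * y       ∎
    where
    distrib : ∀ x y → (1ℚ + (1ℚ + x)) * y ≡ (1ℚ + 1ℚ) * y + x * y
    distrib = solve-∀ ℚ-ring

  euler-atSquare : ∀ a n → ℕ→ℚ n * atSquare a n ≡ atSquare (twiceEuler a) n
  euler-atSquare a zero = refl
  euler-atSquare a (suc zero) = *-zeroʳ (ℕ→ℚ 1)
  euler-atSquare a (suc (suc m)) = begin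
    ℕ→ℚ (2 ℕ.+ m) * atSquare (tail a) m
      ≡⟨ ℕ→ℚ-2+ m (atSquare (tail a) m) ⟩
    (1ℚ + 1ℚ) * atSquare (tail a) m + ℕ→ℚ m * atSquare (tail a) m
      ≡⟨ cong ((1ℚ + 1ℚ) * atSquare (tail a) m +_) (euler-atSquare (tail a) m) ⟩
    (1ℚ + 1ℚ) * atSquare (tail a) m + atSquare (twiceEuler (tail a)) m
      ≡⟨ sym (trans (atSquare-cong tail-twiceEuler m)
                    (trans (atSquare-⊕ ((1ℚ + 1ℚ) · tail a) (twiceEuler (tail a)) m)
                           (cong (_+ atSquare (twiceEuler (tail a)) m) (atSquare-· (1ℚ + 1ℚ) (tail a) m)))) ⟩
    atSquare (tail (twiceEuler a)) m ∎
    where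
    tail-twiceEuler : tail (twiceEuler a) ≋ ((1ℚ + 1ℚ) · tail a) ⊕ twiceEuler (tail a)
    tail-twiceEuler s = trans (cong (λ z → ℕ→ℚ z * a (suc s)) (ℕP.+-suc (suc s) s)) (ℕ→ℚ-2+ (s ℕ.+ s) (a (suc s)))

  atSquare-𝟙 : atSquare 𝟙 ≋ 𝟙
  atSquare-𝟙 zero = refl
  atSquare-𝟙 (suc zero) = refl
  atSquare-𝟙 (suc (suc m)) = atSquare-𝟘 (tail 𝟙) (λ _ → refl) m

  x²-atSquare : shift 𝕏 ≋ atSquare 𝕏
  x²-atSquare zero = refl
  x²-atSquare (suc zero) = refl
  x²-atSquare (suc (suc m)) = sym (atSquare-𝟙 m)

  -- (−1)ⁿ, and alternate a = a(−x)
  sign : ℕ → ℚ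
  sign zero = 1ℚ
  sign (suc n) = - sign n

  alternate : Series → Series
  alternate a n = sign n * a n

  alternate-⋆ : ∀ a b → alternate a ⋆ alternate b ≋ alternate (a ⋆ b)
  alternate-⋆ a b zero = regroup (a 0) (b 0)
    where
    regroup : ∀ x y → (1ℚ * x) * (1ℚ * y) ≡ 1ℚ * (x * y)
    regroup = solve-∀ ℚ-ring
  alternate-⋆ a b (suc m) = begin
    (1ℚ * a 0) * (- sign m * b (suc m)) + (tail (alternate a) ⋆ alternate b) m
      ≡⟨ cong ((1ℚ * a 0) * (- sign m * b (suc m)) +_)
              (trans (⋆-congˡ (alternate b) tail-alternate m)
                     (trans (⋆-scaleˡ (- 1ℚ) (alternate (tail a)) (alternate b) m)
                            (cong ((- 1ℚ) *_) (alternate-⋆ (tail a) b m)))) ⟩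
    (1ℚ * a 0) * (- sign m * b (suc m)) + (- 1ℚ) * (sign m * (tail a ⋆ b) m)
      ≡⟨ regroup (a 0) (sign m) (b (suc m)) ((tail a ⋆ b) m) ⟩
    - sign m * (a 0 * b (suc m) + (tail a ⋆ b) m) ∎
    where
    tail-alternate : tail (alternate a) ≋ (- 1ℚ) · alternate (tail a)
    tail-alternate i = negate (sign i) (a (suc i))
      where
      negate : ∀ s x → - s * x ≡ (- 1ℚ) * (s * x)
      negate = solve-∀ ℚ-ring
    regroup : ∀ x s y w → (1ℚ * x) * (- s * y) + (- 1ℚ) * (s * w) ≡ - s * (x * y + w)
    regroup = solve-∀ ℚ-ring
open Substitution

-- Let bmag be given by bmag₀ = 1/12 and
-- (2r+5)·bmag_{r+1} = Σ_{i≤r} bmagᵢ bmag_{r−i}; it will turn out that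
-- bmag_r = |B_{2r+2}|/(2r+2)!.  The even series H(x) = 1 + Σ_r (−1)ʳ bmag_r x^{2r+2}
-- satisfies x·H′ + H² − H = x²/4, so H − x/2 solves the Riccati equation
-- and therefore equals β.
module EvenCoefficients where
  open ≡-Reasoning

  private
    bmag-step : ℕ → Series → ℚ
    bmag-step zero _ = recip 11
    bmag-step (suc r) s = recip (4 ℕ.+ (r ℕ.+ r)) * (s ⋆ s) r

    bmag-step-local : ∀ n s s′ → (∀ m → m ℕ.< n → s m ≡ s′ m) → bmag-step n s ≡ bmag-step n s′
    bmag-step-local zero s s′ e = refl
    bmag-step-local (suc r) s s′ e = cong (recip (4 ℕ.+ (r ℕ.+ r)) *_)
      (⋆-local r s s′ s s′ (λ m m≤r → e m (s≤s m≤r)) (λ m m≤r → e m (s≤s m≤r)))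

    module bmag-recursion = CourseOfValues bmag-step bmag-step-local

  opaque
    bmag : Series
    bmag = bmag-recursion.fix

    bmag-0 : bmag 0 ≡ recip 11
    bmag-0 = bmag-recursion.fix-eq 0

    bmag-suc : ∀ r → bmag (suc r) ≡ recip (4 ℕ.+ (r ℕ.+ r)) * (bmag ⋆ bmag) r
    bmag-suc r = bmag-recursion.fix-eq (suc r)

  bmag-rec : ∀ r → ℕ→ℚ (5 ℕ.+ (r ℕ.+ r)) * bmag (suc r) ≡ (bmag ⋆ bmag) r
  bmag-rec r = begin
    N * bmag (suc r)                     ≡⟨ cong (N *_) (bmag-suc r) ⟩
    N * (recip (4 ℕ.+ (r ℕ.+ r)) * S)    ≡⟨ sym (*-assoc N (recip (4 ℕ.+ (r ℕ.+ r))) S) ⟩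
    (N * recip (4 ℕ.+ (r ℕ.+ r))) * S    ≡⟨ cong (_* S) (recip-inverse (4 ℕ.+ (r ℕ.+ r))) ⟩
    1ℚ * S                               ≡⟨ *-identityˡ S ⟩
    S                                    ∎
    where
    N = ℕ→ℚ (5 ℕ.+ (r ℕ.+ r))
    S = (bmag ⋆ bmag) r

  private
    ½ ¼ : ℚ
    ½ = recip 1
    ¼ = recip 3

    A : Series
    A = alternate bmag

    -- W(y) = 1 + Σ_r (−1)ʳ bmag_r y^{r+1}, so that H(x) = W(x²)
    W : Series
    W = 𝟙 ⊕ shift A

    H : Series
    H = atSquare W

    β-candidate : Series
    β-candidate = H ⊖ (½ · 𝕏)

    W⋆W : ∀ r → (W ⋆ W) (suc r) ≡ (1ℚ + 0ℚ) * (0ℚ + A r) + ((1ℚ + 0ℚ) * (0ℚ + A r) + shift (A ⋆ A) r)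
    W⋆W r = cong ((1ℚ + 0ℚ) * (0ℚ + A r) +_)
      (trans (⋆-comm (tail W) W r)
      (trans (⋆-unfold W (tail W) r)
             (cong ((1ℚ + 0ℚ) * (0ℚ + A r) +_) (shift-cong (⋆-cong tail-W tail-W) r))))
      where
      tail-W : tail W ≋ A
      tail-W i = +-identityˡ (A i)

    -- the substituted form of x·H′ + H² − H − x²/4 = 0:  2y·W′ + W² − W − y/4 = 0
    W-equation : twiceEuler W ⊕ W ⋆ W ⊖ W ⊖ (¼ · 𝕏) ≋ 𝟘
    W-equation zero = refl
    W-equation (suc zero) = begin
      ((ℕ→ℚ 2 * (0ℚ + 1ℚ * bmag 0) + (W ⋆ W) 1) - (0ℚ + 1ℚ * bmag 0)) - ¼ * 1ℚ
        ≡⟨ cong (λ z → ((ℕ→ℚ 2 * (0ℚ + 1ℚ * bmag 0) + z) - (0ℚ + 1ℚ * bmag 0)) - ¼ * 1ℚ) (W⋆W 0) ⟩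
      ((ℕ→ℚ 2 * (0ℚ + 1ℚ * bmag 0) + ((1ℚ + 0ℚ) * (0ℚ + 1ℚ * bmag 0) + ((1ℚ + 0ℚ) * (0ℚ + 1ℚ * bmag 0) + 0ℚ)))
         - (0ℚ + 1ℚ * bmag 0)) - ¼ * 1ℚ
        ≡⟨ cong (λ y → ((ℕ→ℚ 2 * (0ℚ + 1ℚ * y) + ((1ℚ + 0ℚ) * (0ℚ + 1ℚ * y) + ((1ℚ + 0ℚ) * (0ℚ + 1ℚ * y) + 0ℚ)))
                         - (0ℚ + 1ℚ * y)) - ¼ * 1ℚ) bmag-0 ⟩
      0ℚ ∎
    W-equation (suc (suc q)) = begin
      ((ℕ→ℚ (suc (suc q) ℕ.+ suc (suc q)) * (0ℚ + A (suc q)) + (W ⋆ W) (suc (suc q))) - (0ℚ + A (suc q))) - ¼ * 0ℚ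
        ≡⟨ cong₂ (λ x z → ((x * (0ℚ + A (suc q)) + z) - (0ℚ + A (suc q))) - ¼ * 0ℚ) index (W⋆W (suc q)) ⟩
      ((N * (0ℚ + A (suc q)) + ((1ℚ + 0ℚ) * (0ℚ + A (suc q)) + ((1ℚ + 0ℚ) * (0ℚ + A (suc q)) + (A ⋆ A) q)))
         - (0ℚ + A (suc q))) - ¼ * 0ℚ
        ≡⟨ cong (λ z → ((N * (0ℚ + A (suc q)) + ((1ℚ + 0ℚ) * (0ℚ + A (suc q)) + ((1ℚ + 0ℚ) * (0ℚ + A (suc q)) + z)))
                        - (0ℚ + A (suc q))) - ¼ * 0ℚ) A⋆A ⟩
      ((N * (0ℚ + - sign q * bmag (suc q)) + ((1ℚ + 0ℚ) * (0ℚ + - sign q * bmag (suc q))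
         + ((1ℚ + 0ℚ) * (0ℚ + - sign q * bmag (suc q)) + sign q * ((1ℚ + N) * bmag (suc q)))))
         - (0ℚ + - sign q * bmag (suc q))) - ¼ * 0ℚ
        ≡⟨ vanish N (sign q) (bmag (suc q)) ¼ ⟩
      0ℚ ∎
      where
      N = ℕ→ℚ (4 ℕ.+ (q ℕ.+ q))
      index : ℕ→ℚ (suc (suc q) ℕ.+ suc (suc q)) ≡ N
      index = cong ℕ→ℚ (double q)
        where
        double : ∀ q → suc (suc q) ℕ.+ suc (suc q) ≡ 4 ℕ.+ (q ℕ.+ q)
        double = ℕ-Solver.solve-∀
      A⋆A : (A ⋆ A) q ≡ sign q * ((1ℚ + N) * bmag (suc q))
      A⋆A = trans (alternate-⋆ bmag bmag q)
              (cong (sign q *_) (trans (sym (bmag-rec q)) (cong (_* bmag (suc q)) (ℕ→ℚ-suc (4 ℕ.+ (q ℕ.+ q))))))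
      vanish : ∀ N s y c → ((N * (0ℚ + - s * y) + ((1ℚ + 0ℚ) * (0ℚ + - s * y) + ((1ℚ + 0ℚ) * (0ℚ + - s * y)
                            + s * ((1ℚ + N) * y)))) - (0ℚ + - s * y)) - c * 0ℚ ≡ 0ℚ
      vanish = solve-∀ ℚ-ring

    -- x·H′ + H² − H − x²/4 = 0, by substituting x² into the W-equation
    H-equation : ∀ n → ((shift (D H) n + (H ⋆ H) n) - H n) - ¼ * shift 𝕏 n ≡ 0ℚ
    H-equation n = begin
      ((shift (D H) n + (H ⋆ H) n) - H n) - ¼ * shift 𝕏 n
        ≡⟨ cong₂ (λ x y → ((x + y) - H n) - ¼ * shift 𝕏 n) (trans (shift-D H n) (euler-atSquare W n)) (atSquare-⋆ W W n) ⟩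
      ((atSquare (twiceEuler W) n + atSquare (W ⋆ W) n) - atSquare W n) - ¼ * shift 𝕏 n
        ≡⟨ cong (λ z → ((atSquare (twiceEuler W) n + atSquare (W ⋆ W) n) - atSquare W n) - ¼ * z) (x²-atSquare n) ⟩
      ((atSquare (twiceEuler W) n + atSquare (W ⋆ W) n) - atSquare W n) - ¼ * atSquare 𝕏 n
        ≡⟨ sym (trans (atSquare-⊖ (twiceEuler W ⊕ W ⋆ W ⊖ W) (¼ · 𝕏) n)
                 (cong₂ _-_ (trans (atSquare-⊖ (twiceEuler W ⊕ W ⋆ W) W n)
                                   (cong (_- atSquare W n) (atSquare-⊕ (twiceEuler W) (W ⋆ W) n)))
                            (atSquare-· ¼ 𝕏 n))) ⟩
      atSquare (twiceEuler W ⊕ W ⋆ W ⊖ W ⊖ (¼ · 𝕏)) n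
        ≡⟨ atSquare-𝟘 _ W-equation n ⟩
      0ℚ ∎

    shift-candidate : ∀ n → shift β-candidate n ≡ shift H n - ½ * shift 𝕏 n
    shift-candidate zero = sym (+-identityʳ 0ℚ)
    shift-candidate (suc n) = refl

    x·D-candidate : ∀ n → shift (D β-candidate) n ≡ shift (D H) n - ½ * 𝕏 n
    x·D-candidate zero = refl
    x·D-candidate (suc m) = trans (D-⊖ H (½ · 𝕏) m) (cong (_-_ (D H m)) (trans (D-· ½ 𝕏 m) (cong (½ *_) (D-𝕏 m))))

    candidate² : ∀ n → (β-candidate ⋆ β-candidate) n ≡ ((H ⋆ H) n - (½ + ½) * shift H n) + (½ * ½) * shift 𝕏 n
    candidate² n = begin
      (β-candidate ⋆ β-candidate) n
        ≡⟨ ⋆-distribʳ-⊖ H (½ · 𝕏) β-candidate n ⟩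
      (H ⋆ β-candidate) n - ((½ · 𝕏) ⋆ β-candidate) n
        ≡⟨ cong₂ _-_ (trans (⋆-distribˡ-⊖ H H (½ · 𝕏) n)
                            (cong (_-_ ((H ⋆ H) n)) (trans (⋆-scaleʳ ½ H 𝕏 n) (cong (½ *_) (trans (⋆-comm H 𝕏 n) (⋆-𝕏ˡ H n))))))
                     (trans (⋆-scaleˡ ½ 𝕏 β-candidate n) (cong (½ *_) (trans (⋆-𝕏ˡ β-candidate n) (shift-candidate n)))) ⟩
      ((H ⋆ H) n - ½ * shift H n) - ½ * (shift H n - ½ * shift 𝕏 n)
        ≡⟨ regroup ((H ⋆ H) n) ½ (shift H n) (shift 𝕏 n) ⟩
      ((H ⋆ H) n - (½ + ½) * shift H n) + (½ * ½) * shift 𝕏 n ∎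
      where
      regroup : ∀ a c h x → (a - c * h) - c * (h - c * x) ≡ (a - (c + c) * h) + (c * c) * x
      regroup = solve-∀ ℚ-ring

    -- Substituting a = H − x/2 into the Riccati expression leaves the
    -- left-hand side of the H-equation, because ½ + ½ = 1 and ½·½ − ½ = −¼.
    candidate-Riccati : Riccati β-candidate ≋ 𝟘
    candidate-Riccati n = begin
      ((shift (D β-candidate) n + shift β-candidate n) + (β-candidate ⋆ β-candidate) n) - β-candidate n
        ≡⟨ cong₃ (x·D-candidate n) (shift-candidate n) (candidate² n) ⟩
      ((shift (D H) n - ½ * 𝕏 n + (shift H n - ½ * shift 𝕏 n))
         + (((H ⋆ H) n - (½ + ½) * shift H n) + (½ * ½) * shift 𝕏 n)) - (H n - ½ * 𝕏 n)
        ≡⟨ expand (shift (D H) n) ½ (𝕏 n) (shift H n) (shift 𝕏 n) ((H ⋆ H) n) (H n) ⟩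
      ((shift (D H) n + (H ⋆ H) n) - H n) + (1ℚ - (½ + ½)) * shift H n + (½ * ½ - ½) * shift 𝕏 n
        ≡⟨ simplify ((shift (D H) n + (H ⋆ H) n) - H n) (shift H n) ¼ (shift 𝕏 n) ⟩
      ((shift (D H) n + (H ⋆ H) n) - H n) - ¼ * shift 𝕏 n
        ≡⟨ H-equation n ⟩
      0ℚ ∎
      where
      cong₃ : ∀ {x x′ y y′ z z′} → x ≡ x′ → y ≡ y′ → z ≡ z′ →
              ((x + y) + z) - β-candidate n ≡ ((x′ + y′) + z′) - β-candidate n
      cong₃ refl refl refl = refl
      expand : ∀ a c x h sx hh H → ((a - c * x + (h - c * sx)) + ((hh - (c + c) * h) + (c * c) * sx)) - (H - c * x)
                                 ≡ ((a + hh) - H) + (1ℚ - (c + c)) * h + (c * c - c) * sx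
      expand = solve-∀ ℚ-ring
      simplify : ∀ y h q sx → y + 0ℚ * h + (- q) * sx ≡ y - q * sx
      simplify = solve-∀ ℚ-ring

    β≋candidate : β ≋ β-candidate
    β≋candidate = Riccati-unique β β-candidate β-0 refl β-Riccati candidate-Riccati

  β-even : ∀ r → β (suc (suc (r ℕ.+ r))) ≡ sign r * bmag r
  β-even r = begin
    β (suc (suc (r ℕ.+ r)))                   ≡⟨ β≋candidate (suc (suc (r ℕ.+ r))) ⟩
    atSquare (tail W) (r ℕ.+ r) - ½ * 0ℚ      ≡⟨ cong (_- ½ * 0ℚ) (atSquare-even (tail W) r) ⟩
    (0ℚ + sign r * bmag r) - ½ * 0ℚ           ≡⟨ simplify (sign r * bmag r) ½ ⟩
    sign r * bmag r                           ∎
    where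
    simplify : ∀ x c → (0ℚ + x) - c * 0ℚ ≡ x
    simplify = solve-∀ ℚ-ring

  β-odd : ∀ s → β (suc (suc (suc (s ℕ.+ s)))) ≡ 0ℚ
  β-odd s = begin
    β (suc (suc (suc (s ℕ.+ s))))               ≡⟨ β≋candidate (suc (suc (suc (s ℕ.+ s)))) ⟩
    atSquare (tail W) (suc (s ℕ.+ s)) - ½ * 0ℚ  ≡⟨ cong (_- ½ * 0ℚ) (atSquare-odd (tail W) s) ⟩
    0ℚ - ½ * 0ℚ                                 ≡⟨ refl ⟩
    0ℚ                                          ∎
open EvenCoefficients

-- Positivity and growth of bmag: all bmag_r are positive, and from r = 8
-- on they exceed 1/(2r+1)!, since the recursion gives
-- (2r+7)·bmag_{r+2} ≥ 2·bmag₀·bmag_{r+1} = bmag_{r+1}/6.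
module Growth where
  open ≤-Reasoning

  pos*pos : ∀ {a b} → 0ℚ < a → 0ℚ < b → 0ℚ < a * b
  pos*pos {a} {b} 0<a 0<b = positive⁻¹ (a * b) {{pos*pos⇒pos a {{positive 0<a}} b {{positive 0<b}}}}

  nonNeg*nonNeg : ∀ {a b} → 0ℚ ≤ a → 0ℚ ≤ b → 0ℚ ≤ a * b
  nonNeg*nonNeg {a} {b} 0≤a 0≤b = nonNegative⁻¹ (a * b) {{nonNeg*nonNeg⇒nonNeg a {{nonNegative 0≤a}} b {{nonNegative 0≤b}}}}

  ℕ→ℚ-mono : ∀ {m n} → m ℕ.≤ n → ℕ→ℚ m ≤ ℕ→ℚ n
  ℕ→ℚ-mono {m} {n} m≤n = begin
    ℕ→ℚ m                       ≡⟨ sym (+-identityʳ (ℕ→ℚ m)) ⟩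
    ℕ→ℚ m + 0ℚ                  ≤⟨ +-monoʳ-≤ (ℕ→ℚ m) (ℕ→ℚ-nonNeg (n ℕ.∸ m)) ⟩
    ℕ→ℚ m + ℕ→ℚ (n ℕ.∸ m)       ≡⟨ sym (ℕ→ℚ-+ m (n ℕ.∸ m)) ⟩
    ℕ→ℚ (m ℕ.+ (n ℕ.∸ m))       ≡⟨ cong ℕ→ℚ (ℕP.m+[n∸m]≡n m≤n) ⟩
    ℕ→ℚ n                       ∎

  invfact-pos : ∀ n → 0ℚ < invfact n
  invfact-pos zero = positive⁻¹ 1ℚ
  invfact-pos (suc n) = pos*pos (invfact-pos n) (recip-pos n)

  ⋆-pos : ∀ n a b → (∀ i → i ℕ.≤ n → 0ℚ < a i) → (∀ i → i ℕ.≤ n → 0ℚ < b i) → 0ℚ < (a ⋆ b) n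
  ⋆-pos zero a b 0<a 0<b = pos*pos (0<a 0 z≤n) (0<b 0 z≤n)
  ⋆-pos (suc n) a b 0<a 0<b = +-mono-<-≤ (pos*pos (0<a 0 z≤n) (0<b (suc n) ℕP.≤-refl))
    (<⇒≤ (⋆-pos n (tail a) b (λ i i≤n → 0<a (suc i) (s≤s i≤n)) (λ i i≤n → 0<b i (ℕP.m≤n⇒m≤1+n i≤n))))

  ⋆-lastTerm : ∀ n a b → (∀ i → 0ℚ ≤ a i) → (∀ i → 0ℚ ≤ b i) → a n * b 0 ≤ (a ⋆ b) n
  ⋆-lastTerm zero a b 0≤a 0≤b = ≤-refl
  ⋆-lastTerm (suc n) a b 0≤a 0≤b = begin
    a (suc n) * b 0                      ≡⟨ sym (+-identityˡ (a (suc n) * b 0)) ⟩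
    0ℚ + a (suc n) * b 0                 ≤⟨ +-mono-≤ (nonNeg*nonNeg (0≤a 0) (0≤b (suc n)))
                                                     (⋆-lastTerm n (tail a) b (λ i → 0≤a (suc i)) 0≤b) ⟩
    a 0 * b (suc n) + (tail a ⋆ b) n     ∎

  bmag-pos : ∀ r → 0ℚ < bmag r
  bmag-pos = <-rec (λ r → 0ℚ < bmag r) step
    where
    step : ∀ r → (∀ {i} → i ℕ.< r → 0ℚ < bmag i) → 0ℚ < bmag r
    step zero _ = subst (0ℚ <_) (sym bmag-0) (recip-pos 11)
    step (suc r) ih = subst (0ℚ <_) (sym (bmag-suc r))
      (pos*pos (recip-pos (4 ℕ.+ (r ℕ.+ r))) (⋆-pos r bmag bmag (λ i i≤r → ih (s≤s i≤r)) (λ i i≤r → ih (s≤s i≤r))))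

  bmag-nonNeg : ∀ r → 0ℚ ≤ bmag r
  bmag-nonNeg r = <⇒≤ (bmag-pos r)

  bmag-lower : ∀ p → recip 5 * bmag (suc p) ≤ ℕ→ℚ (5 ℕ.+ (suc p ℕ.+ suc p)) * bmag (suc (suc p))
  bmag-lower p = begin
    recip 5 * bmag (suc p)                   ≡⟨ cong (_* bmag (suc p)) (sym (cong₂ _+_ bmag-0 bmag-0)) ⟩
    (bmag 0 + bmag 0) * bmag (suc p)         ≡⟨ distrib (bmag 0) (bmag (suc p)) ⟩
    bmag 0 * bmag (suc p) + bmag (suc p) * bmag 0
      ≤⟨ +-monoʳ-≤ (bmag 0 * bmag (suc p)) (⋆-lastTerm p (tail bmag) bmag (λ i → bmag-nonNeg (suc i)) bmag-nonNeg) ⟩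
    bmag 0 * bmag (suc p) + (tail bmag ⋆ bmag) p
      ≡⟨ sym (bmag-rec (suc p)) ⟩
    ℕ→ℚ (5 ℕ.+ (suc p ℕ.+ suc p)) * bmag (suc (suc p)) ∎
    where
    distrib : ∀ a x → (a + a) * x ≡ a * x + x * a
    distrib = solve-∀ ℚ-ring

  oddInvfact : ℕ → ℚ
  oddInvfact r = invfact (suc (r ℕ.+ r))

  growth-inequality : ∀ t → let r = 3 ℕ.+ t in
    6 ℕ.* (5 ℕ.+ (r ℕ.+ r)) ℕ.≤ (2 ℕ.+ (r ℕ.+ r)) ℕ.* (3 ℕ.+ (r ℕ.+ r))
  growth-inequality t = subst (6 ℕ.* (5 ℕ.+ (r ℕ.+ r)) ℕ.≤_) (sym (expand t)) (ℕP.m≤m+n _ _)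
    where
    r = 3 ℕ.+ t
    expand : ∀ t → (2 ℕ.+ ((3 ℕ.+ t) ℕ.+ (3 ℕ.+ t))) ℕ.* (3 ℕ.+ ((3 ℕ.+ t) ℕ.+ (3 ℕ.+ t)))
                 ≡ 6 ℕ.* (5 ℕ.+ ((3 ℕ.+ t) ℕ.+ (3 ℕ.+ t))) ℕ.+ (6 ℕ.+ 22 ℕ.* t ℕ.+ 4 ℕ.* (t ℕ.* t))
    expand = ℕ-Solver.solve-∀

  growth-step : ∀ t → oddInvfact (3 ℕ.+ t) < bmag (3 ℕ.+ t) → oddInvfact (4 ℕ.+ t) < bmag (4 ℕ.+ t)
  growth-step t hyp = subst (λ z → invfact z < bmag (suc r)) (sym index)
    (*-cancelˡ-<-nonNeg N {{nonNegative (ℕ→ℚ-nonNeg (5 ℕ.+ (r ℕ.+ r)))}}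
      (*-cancelˡ-<-nonNeg (ℕ→ℚ 6) {{nonNegative (ℕ→ℚ-nonNeg 6)}} chain))
    where
    r = 3 ℕ.+ t
    N = ℕ→ℚ (5 ℕ.+ (r ℕ.+ r))
    I = invfact (3 ℕ.+ (r ℕ.+ r))
    index : suc (suc r ℕ.+ suc r) ≡ 3 ℕ.+ (r ℕ.+ r)
    index = cong (λ z → suc (suc z)) (ℕP.+-suc r r)
    six : ℕ→ℚ 6 * N ≤ ℕ→ℚ (2 ℕ.+ (r ℕ.+ r)) * ℕ→ℚ (3 ℕ.+ (r ℕ.+ r))
    six = subst₂ _≤_ (ℕ→ℚ-* 6 (5 ℕ.+ (r ℕ.+ r))) (ℕ→ℚ-* (2 ℕ.+ (r ℕ.+ r)) (3 ℕ.+ (r ℕ.+ r)))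
                 (ℕ→ℚ-mono (growth-inequality t))
    chain : ℕ→ℚ 6 * (N * I) < ℕ→ℚ 6 * (N * bmag (suc r))
    chain = begin-strict
      ℕ→ℚ 6 * (N * I)                                    ≡⟨ sym (*-assoc (ℕ→ℚ 6) N I) ⟩
      (ℕ→ℚ 6 * N) * I                                    ≤⟨ *-monoʳ-≤-nonNeg I {{nonNegative (<⇒≤ (invfact-pos (3 ℕ.+ (r ℕ.+ r))))}} six ⟩
      (ℕ→ℚ (2 ℕ.+ (r ℕ.+ r)) * ℕ→ℚ (3 ℕ.+ (r ℕ.+ r))) * I ≡⟨ *-assoc (ℕ→ℚ (2 ℕ.+ (r ℕ.+ r))) (ℕ→ℚ (3 ℕ.+ (r ℕ.+ r))) I ⟩
      ℕ→ℚ (2 ℕ.+ (r ℕ.+ r)) * (ℕ→ℚ (3 ℕ.+ (r ℕ.+ r)) * I) ≡⟨ cong (ℕ→ℚ (2 ℕ.+ (r ℕ.+ r)) *_) (invfact-step (2 ℕ.+ (r ℕ.+ r))) ⟩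
      ℕ→ℚ (2 ℕ.+ (r ℕ.+ r)) * invfact (2 ℕ.+ (r ℕ.+ r))   ≡⟨ invfact-step (suc (r ℕ.+ r)) ⟩
      oddInvfact r                                       <⟨ hyp ⟩
      bmag r                                             ≡⟨ sym (trans (sym (*-assoc (ℕ→ℚ 6) (recip 5) (bmag r)))
                                                                   (trans (cong (_* bmag r) (recip-inverse 5)) (*-identityˡ (bmag r)))) ⟩
      ℕ→ℚ 6 * (recip 5 * bmag r)                         ≤⟨ *-monoˡ-≤-nonNeg (ℕ→ℚ 6) {{nonNegative (ℕ→ℚ-nonNeg 6)}} (bmag-lower (2 ℕ.+ t)) ⟩
      ℕ→ℚ 6 * (N * bmag (suc r))                         ∎
open Growth

-- The coefficients Bₙ/n! for n ≤ 18, checked against the recursion for β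
-- by evaluation; they settle the small cases.
module SmallCoefficients where
  open ≡-Reasoning

  checkBelow : {P : ℕ → Set} (P? : ∀ n → Dec (P n)) (N : ℕ) →
               True (all? (λ (i : Fin N) → P? (toℕ i))) → ∀ n → n ℕ.< N → P n
  checkBelow {P} P? N ok n n<N = subst P (toℕ-fromℕ< n<N) (toWitness ok (fromℕ< n<N))

  βtable : ℕ → ℚ
  βtable 0 = 1ℚ
  βtable 1 = - (ℤ.+ 1 / 2)
  βtable 2 = ℤ.+ 1 / 12
  βtable 4 = - (ℤ.+ 1 / 720)
  βtable 6 = ℤ.+ 1 / 30240
  βtable 8 = - (ℤ.+ 1 / 1209600)
  βtable 10 = ℤ.+ 1 / 47900160
  βtable 12 = - (ℤ.+ 691 / 1307674368000)
  βtable 14 = ℤ.+ 1 / 74724249600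
  βtable 16 = - (ℤ.+ 3617 / 10670622842880000)
  βtable 18 = ℤ.+ 43867 / 5109094217170944000
  βtable _ = 0ℚ

  βtable-step : ∀ n → n ℕ.< 18 → - (tail U ⋆ βtable) n ≡ βtable (suc n)
  βtable-step = checkBelow (λ n → - (tail U ⋆ βtable) n ≟ βtable (suc n)) 18 _

  β≡βtable : ∀ n → n ℕ.≤ 18 → β n ≡ βtable n
  β≡βtable = <-rec (λ n → n ℕ.≤ 18 → β n ≡ βtable n) step
    where
    step : ∀ n → (∀ {m} → m ℕ.< n → m ℕ.≤ 18 → β m ≡ βtable m) → n ℕ.≤ 18 → β n ≡ βtable n
    step zero _ _ = β-0
    step (suc n) ih n<18 = begin
      β (suc n)                 ≡⟨ β-rec n ⟩
      - (tail U ⋆ β) n          ≡⟨ cong -_ (⋆-local n (tail U) (tail U) β βtable (λ _ _ → refl)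
                                     (λ m m≤n → ih (s≤s m≤n) (ℕP.≤-trans m≤n (ℕP.<⇒≤ n<18)))) ⟩
      - (tail U ⋆ βtable) n     ≡⟨ βtable-step n n<18 ⟩
      βtable (suc n)            ∎

  bmag-8 : oddInvfact 8 < bmag 8
  bmag-8 = subst (oddInvfact 8 <_) bmag-8≡ (toWitness {a? = oddInvfact 8 <? βtable 18} _)
    where
    bmag-8≡ : βtable 18 ≡ bmag 8
    bmag-8≡ = trans (sym (β≡βtable 18 ℕP.≤-refl)) (trans (β-even 8) (*-identityˡ (bmag 8)))

  bmag-large : ∀ r → 8 ℕ.≤ r → oddInvfact r < bmag r
  bmag-large r 8≤r = subst (λ z → oddInvfact z < bmag z) (ℕP.m+[n∸m]≡n 8≤r) (from8 (r ℕ.∸ 8))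
    where
    from8 : ∀ t → oddInvfact (8 ℕ.+ t) < bmag (8 ℕ.+ t)
    from8 zero = bmag-8
    from8 (suc t) = growth-step (5 ℕ.+ t) (from8 t)

  small-positive : ∀ m → m ℕ.≤ 18 → 2 ℕ.≤ m → 0ℚ < βtable m + invfact (m ℕ.∸ 1)
  small-positive m m≤18 = checkBelow (λ m → (2 ℕ.≤? m) →-dec (0ℚ <? βtable m + invfact (m ℕ.∸ 1))) 19 _ m (s≤s m≤18)
open SmallCoefficients

-- For m ≥ 2 the number β_m + 1/(m−1)! is negative exactly when 20 ≤ m and
-- 4 ∣ m, and positive otherwise: odd m ≥ 3 give β_m = 0, m = 2r+2 gives
-- β_m = (−1)ʳ·bmag_r, and for r ≥ 8 the term bmag_r beats 1/(2r+1)!.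
module SignPattern where

  NegativeIndex : ℕ → Set
  NegativeIndex m = (20 ℕ.≤ m) × (4 ∣ m)

  Signed : ℕ → ℚ → Set
  Signed m x = (NegativeIndex m × (x < 0ℚ)) ⊎ (¬ NegativeIndex m × (0ℚ < x))

  Signed-⇔ : ∀ {m x} → Signed m x → (x < 0ℚ) ⇔ NegativeIndex m
  Signed-⇔ (inj₁ (neg , x<0)) = mk⇔ (λ _ → neg) (λ _ → x<0)
  Signed-⇔ (inj₂ (¬neg , 0<x)) = mk⇔ (λ x<0 → contradiction 0<x (<-asym x<0)) (λ neg → contradiction neg ¬neg)

  Signed-scale : ∀ {m c x} → 0ℚ < c → Signed m x → Signed m (c * x)
  Signed-scale {c = c} {x} 0<c (inj₁ (neg , x<0)) =
    inj₁ (neg , subst (c * x <_) (*-zeroʳ c) (*-monoʳ-<-pos c {{positive 0<c}} x<0))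
  Signed-scale 0<c (inj₂ (¬neg , 0<x)) = inj₂ (¬neg , pos*pos 0<c 0<x)

  Signed-positive : ∀ {m x} → ¬ NegativeIndex m → Signed m x → 0ℚ < x
  Signed-positive ¬neg (inj₁ (neg , _)) = contradiction neg ¬neg
  Signed-positive ¬neg (inj₂ (_ , 0<x)) = 0<x

  SignOf : ℕ → Set
  SignOf m = Signed m (β m + invfact (m ℕ.∸ 1))

  parity : ∀ m → Σ ℕ (λ s → (m ≡ s ℕ.+ s) ⊎ (m ≡ suc (s ℕ.+ s)))
  parity zero = 0 , inj₁ refl
  parity (suc m) with parity m
  ... | s , inj₁ m≡2s = s , inj₂ (cong suc m≡2s)
  ... | s , inj₂ m≡2s+1 = suc s , inj₁ (trans (cong suc m≡2s+1) (cong suc (sym (ℕP.+-suc s s))))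

  4∤4q+2 : ∀ q → ¬ (4 ∣ suc (suc ((q ℕ.+ q) ℕ.+ (q ℕ.+ q))))
  4∤4q+2 q 4∣ with trans (sym ([m+kn]%n≡m%n 2 q 4)) (n∣m⇒m%n≡0 _ 4 (subst (4 ∣_) (form q) 4∣))
    where
    form : ∀ q → suc (suc ((q ℕ.+ q) ℕ.+ (q ℕ.+ q))) ≡ 2 ℕ.+ q ℕ.* 4
    form = ℕ-Solver.solve-∀
  ... | ()

  4∤2s+3 : ∀ s → ¬ (4 ∣ suc (suc (suc (s ℕ.+ s))))
  4∤2s+3 s 4∣ with trans (sym ([m+kn]%n≡m%n 1 (suc s) 2)) (n∣m⇒m%n≡0 _ 2 (∣-trans (divides 2 refl) (subst (4 ∣_) (form s) 4∣)))
    where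
    form : ∀ s → suc (suc (suc (s ℕ.+ s))) ≡ 1 ℕ.+ suc s ℕ.* 2
    form = ℕ-Solver.solve-∀
  ... | ()

  4∣4q+4 : ∀ q → 4 ∣ suc (suc (suc (q ℕ.+ q) ℕ.+ suc (q ℕ.+ q)))
  4∣4q+4 q = divides (suc q) (form q)
    where
    form : ∀ q → suc (suc (suc (q ℕ.+ q) ℕ.+ suc (q ℕ.+ q))) ≡ suc q ℕ.* 4
    form = ℕ-Solver.solve-∀

  sign-even : ∀ q → sign (q ℕ.+ q) ≡ 1ℚ
  sign-even zero = refl
  sign-even (suc q) = trans (cong (λ z → sign (suc z)) (ℕP.+-suc q q)) (trans (double-negation (sign (q ℕ.+ q))) (sign-even q))
    where
    double-negation : ∀ x → - (- x) ≡ x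
    double-negation = solve-∀ ℚ-ring

  sign-odd : ∀ q → sign (suc (q ℕ.+ q)) ≡ - 1ℚ
  sign-odd q = cong -_ (sign-even q)

  odd-case : ∀ s → SignOf (suc (suc (suc (s ℕ.+ s))))
  odd-case s = inj₂ ((λ neg → 4∤2s+3 s (proj₂ neg)) ,
    subst (λ z → 0ℚ < z + invfact (suc (suc (s ℕ.+ s)))) (sym (β-odd s))
          (subst (0ℚ <_) (sym (+-identityˡ (invfact (suc (suc (s ℕ.+ s)))))) (invfact-pos (suc (suc (s ℕ.+ s))))))

  even-case : ∀ r → 19 ℕ.≤ suc (suc (r ℕ.+ r)) → SignOf (suc (suc (r ℕ.+ r)))
  even-case r 19≤m with parity r
  ... | q , inj₁ r≡2q = inj₂ ((λ neg → 4∤4q+2 q (subst (λ z → 4 ∣ suc (suc (z ℕ.+ z))) r≡2q (proj₂ neg))) , pos)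
    where
    pos : 0ℚ < β (suc (suc (r ℕ.+ r))) + oddInvfact r
    pos = subst (λ z → 0ℚ < z + oddInvfact r)
            (sym (trans (β-even r) (trans (cong (_* bmag r) (trans (cong sign r≡2q) (sign-even q))) (*-identityˡ (bmag r)))))
            (+-mono-<-≤ (bmag-pos r) (<⇒≤ (invfact-pos (suc (r ℕ.+ r)))))
  ... | q , inj₂ r≡2q+1 = inj₁ ((20≤m , 4∣m) , neg)
    where
    4∣m : 4 ∣ suc (suc (r ℕ.+ r))
    4∣m = subst (λ z → 4 ∣ suc (suc (z ℕ.+ z))) (sym r≡2q+1) (4∣4q+4 q)
    20≤m : 20 ℕ.≤ suc (suc (r ℕ.+ r))
    20≤m = ℕP.≤∧≢⇒< 19≤m (λ 19≡m → 4∤2s+3 8 (subst (4 ∣_) (sym 19≡m) 4∣m))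
    8≤r : 8 ℕ.≤ r
    8≤r with 8 ℕ.≤? r
    ... | yes 8≤r = 8≤r
    ... | no 8≰r = contradiction 19≤m (ℕP.<⇒≱ (ℕP.≤-trans (s≤s (s≤s (s≤s (ℕP.+-mono-≤ r≤7 r≤7)))) (ℕP.m≤m+n 17 2)))
      where
      r≤7 : r ℕ.≤ 7
      r≤7 = ℕP.≤-pred (ℕP.≰⇒> 8≰r)
    neg : β (suc (suc (r ℕ.+ r))) + oddInvfact r < 0ℚ
    neg = subst (λ z → z + oddInvfact r < 0ℚ)
            (sym (trans (β-even r) (trans (cong (_* bmag r) (trans (cong sign r≡2q+1) (sign-odd q))) (-1*x≡-x (bmag r)))))
            (subst (- bmag r + oddInvfact r <_) (+-inverseˡ (bmag r)) (+-monoʳ-< (- bmag r) (bmag-large r 8≤r)))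
      where
      -1*x≡-x : ∀ x → (- 1ℚ) * x ≡ - x
      -1*x≡-x = solve-∀ ℚ-ring

  signOf : ∀ m → 2 ℕ.≤ m → SignOf m
  signOf m 2≤m with m ℕ.≤? 18
  ... | yes m≤18 = inj₂ ((λ neg → ℕP.<⇒≱ (s≤s (ℕP.m≤n⇒m≤1+n m≤18)) (proj₁ neg)) ,
                        subst (λ z → 0ℚ < z + invfact (m ℕ.∸ 1)) (sym (β≡βtable m m≤18)) (small-positive m m≤18 2≤m))
  ... | no m≰18 with parity m
  ...   | zero , inj₁ refl = contradiction 2≤m (ℕP.<⇒≱ (s≤s z≤n))
  ...   | suc r , inj₁ refl = subst SignOf (cong suc (sym (ℕP.+-suc r r)))
                                (even-case r (subst (19 ℕ.≤_) (cong suc (ℕP.+-suc r r)) (ℕP.≰⇒> m≰18)))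
  ...   | zero , inj₂ refl = contradiction 2≤m (ℕP.<⇒≱ (s≤s (s≤s z≤n)))
  ...   | suc s , inj₂ refl = subst SignOf (cong (λ z → suc (suc z)) (sym (ℕP.+-suc s s))) (odd-case s)
open SignPattern

module Polynomials where
  open ≡-Reasoning

  sumBelow : ℕ → (ℕ → ℚ) → ℚ
  sumBelow zero φ = 0ℚ
  sumBelow (suc n) φ = φ 0 + sumBelow n (λ j → φ (suc j))

  sumBelow-cong : ∀ n φ ψ → (∀ j → j ℕ.< n → φ j ≡ ψ j) → sumBelow n φ ≡ sumBelow n ψ
  sumBelow-cong zero φ ψ e = refl
  sumBelow-cong (suc n) φ ψ e =
    cong₂ _+_ (e 0 (s≤s z≤n)) (sumBelow-cong n (λ j → φ (suc j)) (λ j → ψ (suc j)) (λ j j<n → e (suc j) (s≤s j<n)))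

  sumBelow-+ : ∀ n φ ψ → sumBelow n (λ j → φ j + ψ j) ≡ sumBelow n φ + sumBelow n ψ
  sumBelow-+ zero φ ψ = refl
  sumBelow-+ (suc n) φ ψ = trans (cong (φ 0 + ψ 0 +_) (sumBelow-+ n (λ j → φ (suc j)) (λ j → ψ (suc j))))
    (regroup (φ 0) (ψ 0) (sumBelow n (λ j → φ (suc j))) (sumBelow n (λ j → ψ (suc j))))
    where
    regroup : ∀ a b c d → a + b + (c + d) ≡ (a + c) + (b + d)
    regroup = solve-∀ ℚ-ring

  sumBelow-- : ∀ n φ ψ → sumBelow n (λ j → φ j - ψ j) ≡ sumBelow n φ - sumBelow n ψ
  sumBelow-- zero φ ψ = refl
  sumBelow-- (suc n) φ ψ = trans (cong (φ 0 - ψ 0 +_) (sumBelow-- n (λ j → φ (suc j)) (λ j → ψ (suc j))))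
    (regroup (φ 0) (ψ 0) (sumBelow n (λ j → φ (suc j))) (sumBelow n (λ j → ψ (suc j))))
    where
    regroup : ∀ a b c d → a - b + (c - d) ≡ (a + c) - (b + d)
    regroup = solve-∀ ℚ-ring

  sumBelow-* : ∀ n c φ → sumBelow n (λ j → c * φ j) ≡ c * sumBelow n φ
  sumBelow-* zero c φ = sym (*-zeroʳ c)
  sumBelow-* (suc n) c φ = trans (cong (c * φ 0 +_) (sumBelow-* n c (λ j → φ (suc j))))
    (sym (*-distribˡ-+ c (φ 0) (sumBelow n (λ j → φ (suc j)))))

  sumBelow-last : ∀ n φ → sumBelow (suc n) φ ≡ sumBelow n φ + φ n
  sumBelow-last zero φ = trans (+-identityʳ (φ 0)) (sym (+-identityˡ (φ 0)))
  sumBelow-last (suc n) φ = trans (cong (φ 0 +_) (sumBelow-last n (λ j → φ (suc j))))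
    (sym (+-assoc (φ 0) (sumBelow n (λ j → φ (suc j))) (φ (suc n))))

  sumBelow-zero : ∀ n φ → (∀ j → φ j ≡ 0ℚ) → sumBelow n φ ≡ 0ℚ
  sumBelow-zero zero φ e = refl
  sumBelow-zero (suc n) φ e = trans (cong₂ _+_ (e 0) (sumBelow-zero n (λ j → φ (suc j)) (λ j → e (suc j)))) (+-identityʳ 0ℚ)

  ⋆-as-sum : ∀ n a b → (a ⋆ b) n ≡ sumBelow (suc n) (λ i → a i * b (n ℕ.∸ i))
  ⋆-as-sum zero a b = sym (+-identityʳ (a 0 * b 0))
  ⋆-as-sum (suc n) a b = cong (a 0 * b (suc n) +_) (⋆-as-sum n (tail a) b)

  fromCoeffs : (ℕ → ℚ) → ℕ → Poly
  fromCoeffs c zero = []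
  fromCoeffs c (suc n) = c 0 ∷ fromCoeffs (λ j → c (suc j)) n

  eval-fromCoeffs : ∀ c n x → eval (fromCoeffs c n) x ≡ sumBelow n (λ j → c j * pow x j)
  eval-fromCoeffs c zero x = refl
  eval-fromCoeffs c (suc n) x = begin
    c 0 + x * eval (fromCoeffs (λ j → c (suc j)) n) x
      ≡⟨ cong (λ z → c 0 + x * z) (eval-fromCoeffs (λ j → c (suc j)) n x) ⟩
    c 0 + x * sumBelow n (λ j → c (suc j) * pow x j)
      ≡⟨ cong₂ _+_ (sym (*-identityʳ (c 0))) (sym (sumBelow-* n x (λ j → c (suc j) * pow x j))) ⟩
    c 0 * 1ℚ + sumBelow n (λ j → x * (c (suc j) * pow x j))
      ≡⟨ cong (c 0 * 1ℚ +_) (sumBelow-cong n _ _ (λ j _ → swap x (c (suc j)) (pow x j))) ⟩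
    c 0 * 1ℚ + sumBelow n (λ j → c (suc j) * (x * pow x j)) ∎
    where
    swap : ∀ x a p → x * (a * p) ≡ a * (x * p)
    swap = solve-∀ ℚ-ring

  coeff-fromCoeffs : ∀ c n j → j ℕ.< n → coeff (fromCoeffs c n) j ≡ c j
  coeff-fromCoeffs c (suc n) zero _ = refl
  coeff-fromCoeffs c (suc n) (suc j) (s≤s j<n) = coeff-fromCoeffs (λ i → c (suc i)) n j j<n

  _−ₚ_ : Poly → Poly → Poly
  [] −ₚ [] = []
  [] −ₚ (b ∷ bs) = (0ℚ - b) ∷ ([] −ₚ bs)
  (a ∷ as) −ₚ [] = (a - 0ℚ) ∷ (as −ₚ [])
  (a ∷ as) −ₚ (b ∷ bs) = (a - b) ∷ (as −ₚ bs)

  eval-−ₚ : ∀ p q x → eval (p −ₚ q) x ≡ eval p x - eval q x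
  eval-−ₚ [] [] x = refl
  eval-−ₚ [] (b ∷ bs) x = trans (cong (λ z → (0ℚ - b) + x * z) (eval-−ₚ [] bs x)) (regroup b x (eval bs x))
    where
    regroup : ∀ b x e → (0ℚ - b) + x * (0ℚ - e) ≡ 0ℚ - (b + x * e)
    regroup = solve-∀ ℚ-ring
  eval-−ₚ (a ∷ as) [] x = trans (cong (λ z → (a - 0ℚ) + x * z) (eval-−ₚ as [] x)) (regroup a x (eval as x))
    where
    regroup : ∀ a x e → (a - 0ℚ) + x * (e - 0ℚ) ≡ (a + x * e) - 0ℚ
    regroup = solve-∀ ℚ-ring
  eval-−ₚ (a ∷ as) (b ∷ bs) x = trans (cong (λ z → (a - b) + x * z) (eval-−ₚ as bs x)) (regroup a b x (eval as x) (eval bs x))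
    where
    regroup : ∀ a b x e g → (a - b) + x * (e - g) ≡ (a + x * e) - (b + x * g)
    regroup = solve-∀ ℚ-ring

  coeff-−ₚ : ∀ p q j → coeff (p −ₚ q) j ≡ coeff p j - coeff q j
  coeff-−ₚ [] [] j = refl
  coeff-−ₚ [] (b ∷ bs) zero = refl
  coeff-−ₚ [] (b ∷ bs) (suc j) = coeff-−ₚ [] bs j
  coeff-−ₚ (a ∷ as) [] zero = refl
  coeff-−ₚ (a ∷ as) [] (suc j) = coeff-−ₚ as [] j
  coeff-−ₚ (a ∷ as) (b ∷ bs) zero = refl
  coeff-−ₚ (a ∷ as) (b ∷ bs) (suc j) = coeff-−ₚ as bs j

  -- division by (x − c) with remainder (Horner's scheme)
  divide : ℚ → Poly → Poly × ℚ
  divide c [] = [] , 0ℚ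
  divide c (a ∷ []) = [] , a
  divide c (a ∷ b ∷ rest) =
    (proj₂ (divide c (b ∷ rest)) ∷ proj₁ (divide c (b ∷ rest))) , a + c * proj₂ (divide c (b ∷ rest))

  quotient : ℚ → Poly → Poly
  quotient c p = proj₁ (divide c p)

  remainder : ℚ → Poly → ℚ
  remainder c p = proj₂ (divide c p)

  eval-divide : ∀ c p x → eval p x ≡ (x - c) * eval (quotient c p) x + remainder c p
  eval-divide c [] x = sym (vanish x c)
    where
    vanish : ∀ x c → (x - c) * 0ℚ + 0ℚ ≡ 0ℚ
    vanish = solve-∀ ℚ-ring
  eval-divide c (a ∷ []) x = regroup a x c
    where
    regroup : ∀ a x c → a + x * 0ℚ ≡ (x - c) * 0ℚ + a
    regroup = solve-∀ ℚ-ring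
  eval-divide c (a ∷ b ∷ rest) x =
    trans (cong (λ z → a + x * z) (eval-divide c (b ∷ rest) x))
          (regroup a x c (eval (quotient c (b ∷ rest)) x) (remainder c (b ∷ rest)))
    where
    regroup : ∀ a x c e r → a + x * ((x - c) * e + r) ≡ (x - c) * (r + x * e) + (a + c * r)
    regroup = solve-∀ ℚ-ring

  length-quotient : ∀ c p n → length p ≡ suc n → length (quotient c p) ≡ n
  length-quotient c (a ∷ []) zero e = refl
  length-quotient c (a ∷ b ∷ rest) (suc n) e = cong suc (length-quotient c (b ∷ rest) n (ℕP.suc-injective e))

  divide-zero : ∀ c p → (∀ j → coeff (quotient c p) j ≡ 0ℚ) → remainder c p ≡ 0ℚ → ∀ j → coeff p j ≡ 0ℚ
  divide-zero c [] q≡0 r≡0 j = refl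
  divide-zero c (a ∷ []) q≡0 r≡0 zero = r≡0
  divide-zero c (a ∷ []) q≡0 r≡0 (suc j) = refl
  divide-zero c (a ∷ b ∷ rest) q≡0 r≡0 zero = begin
    a                       ≡⟨ isolate a c r′ ⟩
    (a + c * r′) - c * r′   ≡⟨ cong₂ (λ u w → u - c * w) r≡0 (q≡0 0) ⟩
    0ℚ - c * 0ℚ             ≡⟨ vanish c ⟩
    0ℚ                      ∎
    where
    r′ = remainder c (b ∷ rest)
    isolate : ∀ a c r → a ≡ (a + c * r) - c * r
    isolate = solve-∀ ℚ-ring
    vanish : ∀ c → 0ℚ - c * 0ℚ ≡ 0ℚ
    vanish = solve-∀ ℚ-ring
  divide-zero c (a ∷ b ∷ rest) q≡0 r≡0 (suc j) = divide-zero c (b ∷ rest) (λ i → q≡0 (suc i)) (q≡0 0) j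

  -- a polynomial of length N vanishing at all integers ≥ c is zero:
  -- it has the root c, and the quotient vanishes at all integers ≥ c + 1
  vanishing-poly : ∀ N p → length p ≡ N → ∀ c → (∀ t → c ℕ.≤ t → eval p (ℕ→ℚ t) ≡ 0ℚ) → ∀ j → coeff p j ≡ 0ℚ
  vanishing-poly zero [] e c vanish j = refl
  vanishing-poly (suc N) p e c vanish =
    divide-zero C p (vanishing-poly N (quotient C p) (length-quotient C p N e) (suc c) q-vanish) r≡0
    where
    C = ℕ→ℚ c
    r≡0 : remainder C p ≡ 0ℚ
    r≡0 = begin
      remainder C p                                        ≡⟨ sym (cancel C (eval (quotient C p) C) (remainder C p)) ⟩
      (C - C) * eval (quotient C p) C + remainder C p      ≡⟨ sym (eval-divide C p C) ⟩
      eval p C                                             ≡⟨ vanish c ℕP.≤-refl ⟩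
      0ℚ                                                   ∎
      where
      cancel : ∀ x e r → (x - x) * e + r ≡ r
      cancel = solve-∀ ℚ-ring
    q-vanish : ∀ t → suc c ℕ.≤ t → eval (quotient C p) (ℕ→ℚ t) ≡ 0ℚ
    q-vanish t c<t = *-cancel-suc d (eval (quotient C p) T) 0ℚ (begin
      ℕ→ℚ (suc d) * eval (quotient C p) T                    ≡⟨ cong (_* eval (quotient C p) T) distance ⟩
      (T - C) * eval (quotient C p) T                        ≡⟨ sym (+-identityʳ _) ⟩
      (T - C) * eval (quotient C p) T + 0ℚ                   ≡⟨ cong ((T - C) * eval (quotient C p) T +_) (sym r≡0) ⟩
      (T - C) * eval (quotient C p) T + remainder C p        ≡⟨ sym (eval-divide C p T) ⟩
      eval p T                                               ≡⟨ vanish t (ℕP.≤-trans (ℕP.n≤1+n c) c<t) ⟩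
      0ℚ                                                     ≡⟨ sym (*-zeroʳ (ℕ→ℚ (suc d))) ⟩
      ℕ→ℚ (suc d) * 0ℚ                                       ∎)
      where
      T = ℕ→ℚ t
      d = t ℕ.∸ suc c
      distance : ℕ→ℚ (suc d) ≡ T - C
      distance = begin
        ℕ→ℚ (suc d)               ≡⟨ isolate (ℕ→ℚ (suc d)) C ⟩
        (ℕ→ℚ (suc d) + C) - C     ≡⟨ cong (_- C) (sym (ℕ→ℚ-+ (suc d) c)) ⟩
        ℕ→ℚ (suc d ℕ.+ c) - C     ≡⟨ cong (λ z → ℕ→ℚ z - C) (trans (sym (ℕP.+-suc d c)) (ℕP.m∸n+n≡m c<t)) ⟩
        T - C                     ∎
        where
        isolate : ∀ a b → a ≡ (a + b) - b
        isolate = solve-∀ ℚ-ring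

  poly-unique : ∀ p q → (∀ t → 1 ℕ.≤ t → eval p (ℕ→ℚ t) ≡ eval q (ℕ→ℚ t)) → ∀ j → coeff p j ≡ coeff q j
  poly-unique p q agree j = begin
    coeff p j                          ≡⟨ isolate (coeff p j) (coeff q j) ⟩
    (coeff p j - coeff q j) + coeff q j
      ≡⟨ cong (_+ coeff q j) (trans (sym (coeff-−ₚ p q j)) (vanishing-poly _ (p −ₚ q) refl 1 difference j)) ⟩
    0ℚ + coeff q j                     ≡⟨ +-identityˡ (coeff q j) ⟩
    coeff q j                          ∎
    where
    isolate : ∀ a b → a ≡ (a - b) + b
    isolate = solve-∀ ℚ-ring
    difference : ∀ t → 1 ℕ.≤ t → eval (p −ₚ q) (ℕ→ℚ t) ≡ 0ℚ
    difference t 1≤t = trans (eval-−ₚ p q (ℕ→ℚ t)) (trans (cong (_- eval q (ℕ→ℚ t)) (agree t 1≤t)) (+-inverseʳ (eval q (ℕ→ℚ t))))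
open Polynomials

-- A point is a vector
-- (x, w₁, …, w_k) with entries in {0,…,t} and x ≤ wᵢ for all i; counting by
-- the value of x (after exchanging the order of summation) gives
-- |t·𝒪_{Q_k} ∩ ℤ^{k+1}| = Σ_{x≤t} (t+1−x)ᵏ.
module Counting where
  open ≡-Reasoning

  length-filter-++ : ∀ {A : Set} {P : Pred A 0ℓ} (P? : Decidable P) xs ys →
    length (filter P? (xs ++ ys)) ≡ length (filter P? xs) ℕ.+ length (filter P? ys)
  length-filter-++ P? xs ys = trans (cong length (filter-++ P? xs ys)) (length-++ (filter P? xs))

  length-filter-map : ∀ {A B : Set} {P : Pred B 0ℓ} (P? : Decidable P) (h : A → B) xs →
    length (filter P? (map h xs)) ≡ length (filter (λ y → P? (h y)) xs)
  length-filter-map P? h [] = refl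
  length-filter-map P? h (x ∷ xs) with does (P? (h x))
  ... | true = cong suc (length-filter-map P? h xs)
  ... | false = length-filter-map P? h xs

  length-filter-concatMap : ∀ {A B : Set} {P : Pred B 0ℓ} (P? : Decidable P) (g : A → List B) xs →
    length (filter P? (concatMap g xs)) ≡ sum (map (λ w → length (filter P? (g w))) xs)
  length-filter-concatMap P? g [] = refl
  length-filter-concatMap P? g (w ∷ ws) =
    trans (length-filter-++ P? (g w) (concatMap g ws)) (cong (length (filter P? (g w)) ℕ.+_) (length-filter-concatMap P? g ws))

  sum-map-cong : ∀ {A : Set} {φ ψ : A → ℕ} → (∀ x → φ x ≡ ψ x) → ∀ xs → sum (map φ xs) ≡ sum (map ψ xs)
  sum-map-cong e xs = cong sum (map-cong e xs)

  sum-map-+ : ∀ {A : Set} (φ ψ : A → ℕ) xs → sum (map (λ x → φ x ℕ.+ ψ x) xs) ≡ sum (map φ xs) ℕ.+ sum (map ψ xs)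
  sum-map-+ φ ψ [] = refl
  sum-map-+ φ ψ (x ∷ xs) = trans (cong (φ x ℕ.+ ψ x ℕ.+_) (sum-map-+ φ ψ xs))
    (regroup (φ x) (ψ x) (sum (map φ xs)) (sum (map ψ xs)))
    where
    regroup : ∀ a b c d → a ℕ.+ b ℕ.+ (c ℕ.+ d) ≡ (a ℕ.+ c) ℕ.+ (b ℕ.+ d)
    regroup = ℕ-Solver.solve-∀

  double-counting : ∀ {X W : Set} {R : X → W → Set} (R? : ∀ x w → Dec (R x w)) B U →
    sum (map (λ w → length (filter (λ x → R? x w) U)) B) ≡ sum (map (λ x → length (filter (λ w → R? x w) B)) U)
  double-counting R? [] U = sym (trans (sum-map-cong (λ _ → refl) U) (sum-zero U))
    where
    sum-zero : ∀ U → sum (map (λ _ → 0) U) ≡ 0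
    sum-zero [] = refl
    sum-zero (_ ∷ U) = sum-zero U
  double-counting R? (w ∷ B) U = begin
    length (filter (λ x → R? x w) U) ℕ.+ sum (map (λ w → length (filter (λ x → R? x w) U)) B)
      ≡⟨ cong₂ ℕ._+_ (count-as-sum U) (double-counting R? B U) ⟩
    sum (map (λ x → length (filter (R? x) (w ∷ []))) U) ℕ.+ sum (map (λ x → length (filter (R? x) B)) U)
      ≡⟨ sym (sum-map-+ (λ x → length (filter (R? x) (w ∷ []))) (λ x → length (filter (R? x) B)) U) ⟩
    sum (map (λ x → length (filter (R? x) (w ∷ [])) ℕ.+ length (filter (R? x) B)) U)
      ≡⟨ sum-map-cong (λ x → sym (length-filter-++ (R? x) (w ∷ []) B)) U ⟩
    sum (map (λ x → length (filter (R? x) (w ∷ B))) U) ∎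
    where
    count-as-sum : ∀ U → length (filter (λ x → R? x w) U) ≡ sum (map (λ x → length (filter (R? x) (w ∷ []))) U)
    count-as-sum [] = refl
    count-as-sum (x ∷ U) with does (R? x w)
    ... | true = cong suc (count-as-sum U)
    ... | false = count-as-sum U

  count-product : ∀ {W : Set} {A : Pred W 0ℓ} {B : Pred ℕ 0ℓ} (A? : Decidable A) (B? : Decidable B) L U →
    sum (map (λ w → length (filter (λ y → B? y ×-dec A? w) U)) L) ≡ length (filter A? L) ℕ.* length (filter B? U)
  count-product A? B? [] U = refl
  count-product A? B? (w ∷ L) U with A? w
  ... | yes a = cong₂ ℕ._+_ (cong length (filter-≐ _ B? (proj₁ , (λ b → b , a)) U)) (count-product A? B? L U)
  ... | no ¬a = cong₂ ℕ._+_ (cong length (filter-none _ (All.universal (λ _ → ¬a ∘ proj₂) U))) (count-product A? B? L U)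

  count-above : ∀ n x → length (filter (x ℕ.≤?_) (upTo n)) ≡ n ℕ.∸ x
  count-above zero x = sym (ℕP.0∸n≡0 x)
  count-above (suc n) x = begin
    length (filter (x ℕ.≤?_) (upTo (suc n)))
      ≡⟨ cong (λ l → length (filter (x ℕ.≤?_) l)) (sym (upTo-∷ʳ n)) ⟩
    length (filter (x ℕ.≤?_) (upTo n ++ n ∷ []))
      ≡⟨ length-filter-++ (x ℕ.≤?_) (upTo n) (n ∷ []) ⟩
    length (filter (x ℕ.≤?_) (upTo n)) ℕ.+ length (filter (x ℕ.≤?_) (n ∷ []))
      ≡⟨ cong (ℕ._+ length (filter (x ℕ.≤?_) (n ∷ []))) (count-above n x) ⟩
    (n ℕ.∸ x) ℕ.+ length (filter (x ℕ.≤?_) (n ∷ []))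
      ≡⟨ last-element ⟩
    suc n ℕ.∸ x ∎
    where
    last-element : (n ℕ.∸ x) ℕ.+ length (filter (x ℕ.≤?_) (n ∷ [])) ≡ suc n ℕ.∸ x
    last-element with x ℕ.≤? n
    ... | yes x≤n = trans (cong (λ l → (n ℕ.∸ x) ℕ.+ length l) (filter-accept (x ℕ.≤?_) x≤n))
                          (trans (ℕP.+-comm (n ℕ.∸ x) 1) (sym (ℕP.+-∸-assoc 1 x≤n)))
    ... | no x≰n = trans (cong (λ l → (n ℕ.∸ x) ℕ.+ length l) (filter-reject (x ℕ.≤?_) x≰n))
                   (trans (ℕP.+-identityʳ (n ℕ.∸ x))
                     (trans (ℕP.m≤n⇒m∸n≡0 (ℕP.<⇒≤ (ℕP.≰⇒> x≰n))) (sym (ℕP.m≤n⇒m∸n≡0 (ℕP.≰⇒> x≰n)))))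

  AllAbove : ∀ {n} → ℕ → Vec ℕ n → Set
  AllAbove x w = ∀ i → x ℕ.≤ lookup w i

  allAbove? : ∀ {n} x (w : Vec ℕ n) → Dec (AllAbove x w)
  allAbove? x w = all? (λ i → x ℕ.≤? lookup w i)

  AllAbove-∷ : ∀ {n} x y (w : Vec ℕ n) → AllAbove x (y ∷ w) ⇔ ((x ℕ.≤ y) × AllAbove x w)
  AllAbove-∷ x y w = mk⇔ (λ above → above zero , (λ i → above (suc i)))
                         (λ { (x≤y , above) zero → x≤y ; (x≤y , above) (suc i) → above i })

  count-box : ∀ t k x → length (filter (allAbove? x) (box t k)) ≡ (suc t ℕ.∸ x) ℕ.^ k
  count-box t zero x = cong length (filter-all (allAbove? x) (All.universal (λ _ ()) (box t zero)))
  count-box t (suc k) x = begin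
    length (filter (allAbove? x) (concatMap (λ v → map (_∷ v) (upTo (suc t))) (box t k)))
      ≡⟨ length-filter-concatMap (allAbove? x) (λ v → map (_∷ v) (upTo (suc t))) (box t k) ⟩
    sum (map (λ w → length (filter (allAbove? x) (map (_∷ w) (upTo (suc t))))) (box t k))
      ≡⟨ sum-map-cong (λ w → trans (length-filter-map (allAbove? x) (_∷ w) (upTo (suc t)))
             (cong length (filter-≐ (λ y → allAbove? x (y ∷ w)) (λ y → (x ℕ.≤? y) ×-dec allAbove? x w)
                                    (to (AllAbove-∷ x _ w) , from (AllAbove-∷ x _ w)) (upTo (suc t))))) (box t k) ⟩
    sum (map (λ w → length (filter (λ y → (x ℕ.≤? y) ×-dec allAbove? x w) (upTo (suc t)))) (box t k))
      ≡⟨ count-product (allAbove? x) (x ℕ.≤?_) (box t k) (upTo (suc t)) ⟩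
    length (filter (allAbove? x) (box t k)) ℕ.* length (filter (x ℕ.≤?_) (upTo (suc t)))
      ≡⟨ cong₂ ℕ._*_ (count-box t k x) (count-above (suc t) x) ⟩
    (suc t ℕ.∸ x) ℕ.^ k ℕ.* (suc t ℕ.∸ x)
      ≡⟨ ℕP.*-comm ((suc t ℕ.∸ x) ℕ.^ k) (suc t ℕ.∸ x) ⟩
    (suc t ℕ.∸ x) ℕ.^ suc k ∎

  RootBelow : ∀ {k} → Vec ℕ (suc k) → Set
  RootBelow (x ∷ w) = AllAbove x w

  rootBelow? : ∀ {k} (v : Vec ℕ (suc k)) → Dec (RootBelow v)
  rootBelow? (x ∷ w) = allAbove? x w

  orderPreserving⇔rootBelow : ∀ k (v : Vec ℕ (suc k)) → OrderPreserving (Q k) v ⇔ RootBelow v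
  orderPreserving⇔rootBelow k (x ∷ w) = mk⇔ (λ op i → op zero (suc i) (inj₂ refl)) from-root
    where
    from-root : AllAbove x w → OrderPreserving (Q k) (x ∷ w)
    from-root above i .i (inj₁ refl) = ℕP.≤-refl
    from-root above .zero zero (inj₂ refl) = ℕP.≤-refl
    from-root above .zero (suc j) (inj₂ refl) = above j

  latticeCount-Q : ∀ k t → latticeCount (Q k) t ≡ sum (map (λ x → (suc t ℕ.∸ x) ℕ.^ k) (upTo (suc t)))
  latticeCount-Q k t = begin
    length (filter (orderPreserving? (Q k)) (box t (suc k)))
      ≡⟨ cong length (filter-≐ (orderPreserving? (Q k)) rootBelow?
           (to (orderPreserving⇔rootBelow k _) , from (orderPreserving⇔rootBelow k _)) (box t (suc k))) ⟩
    length (filter rootBelow? (concatMap (λ v → map (_∷ v) (upTo (suc t))) (box t k)))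
      ≡⟨ length-filter-concatMap rootBelow? (λ v → map (_∷ v) (upTo (suc t))) (box t k) ⟩
    sum (map (λ w → length (filter rootBelow? (map (_∷ w) (upTo (suc t))))) (box t k))
      ≡⟨ sum-map-cong (λ w → length-filter-map rootBelow? (_∷ w) (upTo (suc t))) (box t k) ⟩
    sum (map (λ w → length (filter (λ x → allAbove? x w) (upTo (suc t)))) (box t k))
      ≡⟨ double-counting allAbove? (box t k) (upTo (suc t)) ⟩
    sum (map (λ x → length (filter (allAbove? x) (box t k))) (upTo (suc t)))
      ≡⟨ sum-map-cong (count-box t k) (upTo (suc t)) ⟩
    sum (map (λ x → (suc t ℕ.∸ x) ℕ.^ k) (upTo (suc t))) ∎
open Counting

-- With Sₖ(n) = Σ_{m<n} mᵏ the count is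
-- Sₖ(t+2) − [k = 0] = Sₖ(t) + (t+1)ᵏ + tᵏ − [k = 0]; Faulhaber's formula
-- writes Sₖ(t)/k! as Σ_j (1/j! − [j = 0])·β_{k+1−j}·tʲ and the binomial
-- theorem (via exp t ⋆ exp 1 = exp (t+1)) expands the rest.  This gives
-- explicit coefficients ehrhartCoeff k j, and by the identity theorem they
-- are the coefficients of any polynomial matching the lattice point count.
module EhrhartCoefficients where
  open ≡-Reasoning

  factorial : ℕ → ℚ
  factorial zero = 1ℚ
  factorial (suc n) = ℕ→ℚ (suc n) * factorial n

  factorial-invfact : ∀ n → factorial n * invfact n ≡ 1ℚ
  factorial-invfact zero = refl
  factorial-invfact (suc n) = begin
    ℕ→ℚ (suc n) * factorial n * (invfact n * recip n)   ≡⟨ regroup (ℕ→ℚ (suc n)) (factorial n) (invfact n) (recip n) ⟩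
    (factorial n * invfact n) * (ℕ→ℚ (suc n) * recip n) ≡⟨ cong₂ _*_ (factorial-invfact n) (recip-inverse n) ⟩
    1ℚ                                                  ∎
    where
    regroup : ∀ a b c d → a * b * (c * d) ≡ (b * c) * (a * d)
    regroup = solve-∀ ℚ-ring

  factorial-pos : ∀ k → 0ℚ < factorial k
  factorial-pos zero = positive⁻¹ 1ℚ
  factorial-pos (suc k) = pos*pos (ℕ→ℚ-pos k) (factorial-pos k)

  pow-0 : ∀ k → pow 0ℚ k ≡ 𝟙 k
  pow-0 zero = refl
  pow-0 (suc k) = *-zeroˡ (pow 0ℚ k)

  pow-1 : ∀ k → pow 1ℚ k ≡ 1ℚ
  pow-1 zero = refl
  pow-1 (suc k) = trans (*-identityˡ (pow 1ℚ k)) (pow-1 k)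

  ℕ→ℚ-^ : ∀ a k → ℕ→ℚ (a ℕ.^ k) ≡ pow (ℕ→ℚ a) k
  ℕ→ℚ-^ a zero = refl
  ℕ→ℚ-^ a (suc k) = trans (ℕ→ℚ-* a (a ℕ.^ k)) (cong (ℕ→ℚ a *_) (ℕ→ℚ-^ a k))

  powSum : ℕ → ℕ → ℚ
  powSum k zero = 0ℚ
  powSum k (suc n) = powSum k n + pow (ℕ→ℚ n) k

  leq : ℕ → ℕ → ℚ
  leq zero _ = 1ℚ
  leq (suc j) zero = 0ℚ
  leq (suc j) (suc k) = leq j k

  leq-yes : ∀ j k → j ℕ.≤ k → leq j k ≡ 1ℚ
  leq-yes zero k _ = refl
  leq-yes (suc j) (suc k) (s≤s j≤k) = leq-yes j k j≤k

  leq-no : ∀ k → leq (suc k) k ≡ 0ℚ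
  leq-no zero = refl
  leq-no (suc k) = leq-no k

  -- coefficient of tʲ in Sₖ(t)/k!
  faulhaberCoeff : ℕ → ℕ → ℚ
  faulhaberCoeff k j = (invfact j - 𝟙 j) * β (suc k ℕ.∸ j)

  -- coefficient of tʲ in ((t+1)ᵏ + tᵏ)/k!
  binomialCoeff : ℕ → ℕ → ℚ
  binomialCoeff k j = leq j k * (invfact j * (exp 1ℚ ⊕ 𝟙) (k ℕ.∸ j))

  ehrhartCoeff : ℕ → ℕ → ℚ
  ehrhartCoeff k j = factorial k * (faulhaberCoeff k j + binomialCoeff k j) - 𝟙 j * 𝟙 k

  faulhaber-poly : ∀ t k → powSum k t * invfact k ≡ sumBelow (suc (suc k)) (λ j → faulhaberCoeff k j * pow (ℕ→ℚ t) j)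
  faulhaber-poly t k = begin
    powSum k t * invfact k                     ≡⟨ sym (powerSums-powSum t) ⟩
    shift (powerSums t) (suc k)                ≡⟨ sym (faulhaber t (suc k)) ⟩
    (β ⋆ (exp T ⊖ 𝟙)) (suc k)                  ≡⟨ ⋆-comm β (exp T ⊖ 𝟙) (suc k) ⟩
    ((exp T ⊖ 𝟙) ⋆ β) (suc k)                  ≡⟨ ⋆-as-sum (suc k) (exp T ⊖ 𝟙) β ⟩
    sumBelow (suc (suc k)) (λ j → (exp T ⊖ 𝟙) j * β (suc k ℕ.∸ j))
      ≡⟨ sumBelow-cong (suc (suc k)) _ _ (λ j _ → term j) ⟩
    sumBelow (suc (suc k)) (λ j → faulhaberCoeff k j * pow T j) ∎
    where
    T = ℕ→ℚ t
    powerSums-powSum : ∀ t → powerSums t k ≡ powSum k t * invfact k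
    powerSums-powSum zero = sym (*-zeroˡ (invfact k))
    powerSums-powSum (suc t) = trans (cong (_+ exp (ℕ→ℚ t) k) (powerSums-powSum t))
                                     (sym (*-distribʳ-+ (invfact k) (powSum k t) (pow (ℕ→ℚ t) k)))
    term : ∀ j → (exp T ⊖ 𝟙) j * β (suc k ℕ.∸ j) ≡ faulhaberCoeff k j * pow T j
    term zero = regroup₀ (β (suc k))
      where
      regroup₀ : ∀ b → (1ℚ * 1ℚ - 1ℚ) * b ≡ ((1ℚ - 1ℚ) * b) * 1ℚ
      regroup₀ = solve-∀ ℚ-ring
    term (suc j) = regroup (pow T (suc j)) (invfact (suc j)) (β (suc k ℕ.∸ suc j))
      where
      regroup : ∀ p i b → (p * i - 0ℚ) * b ≡ ((i - 0ℚ) * b) * p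
      regroup = solve-∀ ℚ-ring

  binomial-poly : ∀ t k → (pow (ℕ→ℚ t + 1ℚ) k + pow (ℕ→ℚ t) k) * invfact k
                        ≡ sumBelow (suc (suc k)) (λ j → binomialCoeff k j * pow (ℕ→ℚ t) j)
  binomial-poly t k = begin
    (pow (T + 1ℚ) k + pow T k) * invfact k     ≡⟨ *-distribʳ-+ (invfact k) (pow (T + 1ℚ) k) (pow T k) ⟩
    exp (T + 1ℚ) k + exp T k                   ≡⟨ sym (cong₂ _+_ (exp-+ T 1ℚ k) (⋆-identityʳ (exp T) k)) ⟩
    (exp T ⋆ exp 1ℚ) k + (exp T ⋆ 𝟙) k         ≡⟨ sym (⋆-distribˡ-⊕ (exp T) (exp 1ℚ) 𝟙 k) ⟩
    (exp T ⋆ (exp 1ℚ ⊕ 𝟙)) k                   ≡⟨ ⋆-as-sum k (exp T) (exp 1ℚ ⊕ 𝟙) ⟩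
    sumBelow (suc k) (λ j → exp T j * (exp 1ℚ ⊕ 𝟙) (k ℕ.∸ j))
      ≡⟨ sumBelow-cong (suc k) _ _ term ⟩
    sumBelow (suc k) (λ j → binomialCoeff k j * pow T j)
      ≡⟨ sym (+-identityʳ _) ⟩
    sumBelow (suc k) (λ j → binomialCoeff k j * pow T j) + 0ℚ
      ≡⟨ cong (sumBelow (suc k) (λ j → binomialCoeff k j * pow T j) +_) (sym last-term) ⟩
    sumBelow (suc k) (λ j → binomialCoeff k j * pow T j) + binomialCoeff k (suc k) * pow T (suc k)
      ≡⟨ sym (sumBelow-last (suc k) (λ j → binomialCoeff k j * pow T j)) ⟩
    sumBelow (suc (suc k)) (λ j → binomialCoeff k j * pow T j) ∎
    where
    T = ℕ→ℚ t
    term : ∀ j → j ℕ.< suc k → exp T j * (exp 1ℚ ⊕ 𝟙) (k ℕ.∸ j) ≡ binomialCoeff k j * pow T j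
    term j (s≤s j≤k) = trans (regroup (pow T j) (invfact j) ((exp 1ℚ ⊕ 𝟙) (k ℕ.∸ j)))
                             (cong (λ z → (z * (invfact j * (exp 1ℚ ⊕ 𝟙) (k ℕ.∸ j))) * pow T j) (sym (leq-yes j k j≤k)))
      where
      regroup : ∀ p i x → (p * i) * x ≡ (1ℚ * (i * x)) * p
      regroup = solve-∀ ℚ-ring
    last-term : binomialCoeff k (suc k) * pow T (suc k) ≡ 0ℚ
    last-term = begin
      leq (suc k) k * c * pow T (suc k)  ≡⟨ cong (λ z → z * c * pow T (suc k)) (leq-no k) ⟩
      0ℚ * c * pow T (suc k)             ≡⟨ vanish c (pow T (suc k)) ⟩
      0ℚ                                 ∎
      where
      c = invfact (suc k) * (exp 1ℚ ⊕ 𝟙) (k ℕ.∸ suc k)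
      vanish : ∀ a p → 0ℚ * a * p ≡ 0ℚ
      vanish = solve-∀ ℚ-ring

  constant-poly : ∀ t k → sumBelow (suc (suc k)) (λ j → (𝟙 j * 𝟙 k) * pow (ℕ→ℚ t) j) ≡ 𝟙 k
  constant-poly t k = trans (cong ((1ℚ * 𝟙 k) * 1ℚ +_) (sumBelow-zero (suc k) _ (λ j → vanish (𝟙 k) (pow (ℕ→ℚ t) (suc j)))))
                            (simplify (𝟙 k))
    where
    vanish : ∀ d p → (0ℚ * d) * p ≡ 0ℚ
    vanish = solve-∀ ℚ-ring
    simplify : ∀ d → (1ℚ * d) * 1ℚ + 0ℚ ≡ d
    simplify = solve-∀ ℚ-ring

  ehrhart-values : ∀ t k → sumBelow (suc (suc k)) (λ j → ehrhartCoeff k j * pow (ℕ→ℚ t) j)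
                         ≡ (powSum k t + (pow (ℕ→ℚ t + 1ℚ) k + pow (ℕ→ℚ t) k)) - 𝟙 k
  ehrhart-values t k = begin
    sumBelow K (λ j → ehrhartCoeff k j * pow T j)
      ≡⟨ sumBelow-cong K _ _ (λ j _ → distrib (factorial k) (faulhaberCoeff k j) (binomialCoeff k j) (𝟙 j * 𝟙 k) (pow T j)) ⟩
    sumBelow K (λ j → F j + B j - (𝟙 j * 𝟙 k) * pow T j)
      ≡⟨ sumBelow-- K (λ j → F j + B j) (λ j → (𝟙 j * 𝟙 k) * pow T j) ⟩
    sumBelow K (λ j → F j + B j) - sumBelow K (λ j → (𝟙 j * 𝟙 k) * pow T j)
      ≡⟨ cong₂ _-_ (sumBelow-+ K F B) (constant-poly t k) ⟩
    (sumBelow K F + sumBelow K B) - 𝟙 k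
      ≡⟨ cong (_- 𝟙 k) (cong₂ _+_ (sumBelow-* K (factorial k) (λ j → faulhaberCoeff k j * pow T j))
                                  (sumBelow-* K (factorial k) (λ j → binomialCoeff k j * pow T j))) ⟩
    (factorial k * sumBelow K (λ j → faulhaberCoeff k j * pow T j)
       + factorial k * sumBelow K (λ j → binomialCoeff k j * pow T j)) - 𝟙 k
      ≡⟨ cong (_- 𝟙 k) (cong₂ (λ x y → factorial k * x + factorial k * y) (sym (faulhaber-poly t k)) (sym (binomial-poly t k))) ⟩
    (factorial k * (powSum k t * invfact k) + factorial k * ((pow (T + 1ℚ) k + pow T k) * invfact k)) - 𝟙 k
      ≡⟨ regroup (factorial k) (invfact k) (powSum k t) (pow (T + 1ℚ) k + pow T k) (𝟙 k) ⟩
    (powSum k t + (pow (T + 1ℚ) k + pow T k)) * (factorial k * invfact k) - 𝟙 k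
      ≡⟨ cong (λ z → (powSum k t + (pow (T + 1ℚ) k + pow T k)) * z - 𝟙 k) (factorial-invfact k) ⟩
    (powSum k t + (pow (T + 1ℚ) k + pow T k)) * 1ℚ - 𝟙 k
      ≡⟨ cong (_- 𝟙 k) (*-identityʳ (powSum k t + (pow (T + 1ℚ) k + pow T k))) ⟩
    (powSum k t + (pow (T + 1ℚ) k + pow T k)) - 𝟙 k ∎
    where
    T = ℕ→ℚ t
    K = suc (suc k)
    F B : ℕ → ℚ
    F j = factorial k * (faulhaberCoeff k j * pow T j)
    B j = factorial k * (binomialCoeff k j * pow T j)
    distrib : ∀ f c a d p → (f * (c + a) - d) * p ≡ f * (c * p) + f * (a * p) - d * p
    distrib = solve-∀ ℚ-ring
    regroup : ∀ f i s b d → (f * (s * i) + f * (b * i)) - d ≡ (s + b) * (f * i) - d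
    regroup = solve-∀ ℚ-ring

  -- Σ_{x≤n} (n − x)ᵏ = Sₖ(n+1) − [k = 0]   (the term x = n is 0ᵏ)
  powSum-reversed : ∀ k n → ℕ→ℚ (sum (applyUpTo (λ x → (n ℕ.∸ x) ℕ.^ k) n)) ≡ powSum k (suc n) - 𝟙 k
  powSum-reversed k zero = sym (trans (cong (λ z → (0ℚ + z) - 𝟙 k) (pow-0 k)) (cancel (𝟙 k)))
    where
    cancel : ∀ d → (0ℚ + d) - d ≡ 0ℚ
    cancel = solve-∀ ℚ-ring
  powSum-reversed k (suc n) = begin
    ℕ→ℚ (suc n ℕ.^ k ℕ.+ sum (applyUpTo (λ x → (n ℕ.∸ x) ℕ.^ k) n))
      ≡⟨ ℕ→ℚ-+ (suc n ℕ.^ k) (sum (applyUpTo (λ x → (n ℕ.∸ x) ℕ.^ k) n)) ⟩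
    ℕ→ℚ (suc n ℕ.^ k) + ℕ→ℚ (sum (applyUpTo (λ x → (n ℕ.∸ x) ℕ.^ k) n))
      ≡⟨ cong₂ _+_ (ℕ→ℚ-^ (suc n) k) (powSum-reversed k n) ⟩
    pow (ℕ→ℚ (suc n)) k + (powSum k (suc n) - 𝟙 k)
      ≡⟨ regroup (pow (ℕ→ℚ (suc n)) k) (powSum k (suc n)) (𝟙 k) ⟩
    (powSum k (suc n) + pow (ℕ→ℚ (suc n)) k) - 𝟙 k ∎
    where
    regroup : ∀ a s d → a + (s - d) ≡ (s + a) - d
    regroup = solve-∀ ℚ-ring

  ehrhartPoly : ℕ → Poly
  ehrhartPoly k = fromCoeffs (ehrhartCoeff k) (suc (suc k))

  ehrhartPoly-correct : ∀ k t → eval (ehrhartPoly k) (ℕ→ℚ t) ≡ ℕ→ℚ (latticeCount (Q k) t)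
  ehrhartPoly-correct k t = begin
    eval (ehrhartPoly k) T
      ≡⟨ eval-fromCoeffs (ehrhartCoeff k) (suc (suc k)) T ⟩
    sumBelow (suc (suc k)) (λ j → ehrhartCoeff k j * pow T j)
      ≡⟨ ehrhart-values t k ⟩
    (powSum k t + (pow (T + 1ℚ) k + pow T k)) - 𝟙 k
      ≡⟨ cong (λ z → (powSum k t + (pow z k + pow T k)) - 𝟙 k) (trans (+-comm T 1ℚ) (sym (ℕ→ℚ-suc t))) ⟩
    (powSum k t + (pow (ℕ→ℚ (suc t)) k + pow T k)) - 𝟙 k
      ≡⟨ regroup (powSum k t) (pow (ℕ→ℚ (suc t)) k) (pow T k) (𝟙 k) ⟩
    powSum k (suc (suc t)) - 𝟙 k
      ≡⟨ sym (powSum-reversed k (suc t)) ⟩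
    ℕ→ℚ (sum (applyUpTo (λ x → (suc t ℕ.∸ x) ℕ.^ k) (suc t)))
      ≡⟨ cong (λ l → ℕ→ℚ (sum l)) (sym (map-applyUpTo id (λ x → (suc t ℕ.∸ x) ℕ.^ k) (suc t))) ⟩
    ℕ→ℚ (sum (map (λ x → (suc t ℕ.∸ x) ℕ.^ k) (upTo (suc t))))
      ≡⟨ cong ℕ→ℚ (sym (latticeCount-Q k t)) ⟩
    ℕ→ℚ (latticeCount (Q k) t) ∎
    where
    T = ℕ→ℚ t
    regroup : ∀ s a b d → (s + (a + b)) - d ≡ ((s + b) + a) - d
    regroup = solve-∀ ℚ-ring

  coeff-ehrhart : ∀ k p → IsEhrhartPolyOfOrderPolytope (Q k) p → ∀ j → j ℕ.< suc (suc k) → coeff p j ≡ ehrhartCoeff k j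
  coeff-ehrhart k p ehrhart j j<k+2 =
    trans (poly-unique p (ehrhartPoly k) (λ t 1≤t → trans (ehrhart t 1≤t) (sym (ehrhartPoly-correct k t))) j)
          (coeff-fromCoeffs (ehrhartCoeff k) (suc (suc k)) j j<k+2)
open EhrhartCoefficients

module CoefficientValues where
  open ≡-Reasoning

  ehrhartCoeff-0 : ∀ k → ehrhartCoeff k 0 ≡ 1ℚ
  ehrhartCoeff-0 k = begin
    factorial k * ((1ℚ - 1ℚ) * β (suc k) + 1ℚ * (1ℚ * (pow 1ℚ k * invfact k + 𝟙 k))) - 1ℚ * 𝟙 k
      ≡⟨ cong (λ z → factorial k * ((1ℚ - 1ℚ) * β (suc k) + 1ℚ * (1ℚ * (z * invfact k + 𝟙 k))) - 1ℚ * 𝟙 k) (pow-1 k) ⟩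
    factorial k * ((1ℚ - 1ℚ) * β (suc k) + 1ℚ * (1ℚ * (1ℚ * invfact k + 𝟙 k))) - 1ℚ * 𝟙 k
      ≡⟨ regroup (factorial k) (β (suc k)) (invfact k) (𝟙 k) ⟩
    factorial k * invfact k + (factorial k * 𝟙 k - 𝟙 k)
      ≡⟨ cong₂ _+_ (factorial-invfact k) (trans (cong (_- 𝟙 k) (factorial-𝟙 k)) (+-inverseʳ (𝟙 k))) ⟩
    1ℚ + 0ℚ ∎
    where
    regroup : ∀ f b i d → f * ((1ℚ - 1ℚ) * b + 1ℚ * (1ℚ * (1ℚ * i + d))) - 1ℚ * d ≡ f * i + (f * d - d)
    regroup = solve-∀ ℚ-ring
    factorial-𝟙 : ∀ k → factorial k * 𝟙 k ≡ 𝟙 k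
    factorial-𝟙 zero = refl
    factorial-𝟙 (suc k) = *-zeroʳ (factorial (suc k))

  ehrhartCoeff-middle : ∀ k a → suc a ℕ.< k →
    ehrhartCoeff k (suc a) ≡ (factorial k * invfact (suc a)) * (β (k ℕ.∸ a) + invfact (k ℕ.∸ suc a))
  ehrhartCoeff-middle k a a+1<k = begin
    factorial k * ((i - 0ℚ) * β (k ℕ.∸ a) + leq (suc a) k * (i * (pow 1ℚ (k ℕ.∸ suc a) * i′ + 𝟙 (k ℕ.∸ suc a)))) - 0ℚ * 𝟙 k
      ≡⟨ cong₃ (leq-yes (suc a) k (ℕP.<⇒≤ a+1<k)) (pow-1 (k ℕ.∸ suc a)) (𝟙-gap k a a+1<k) ⟩
    factorial k * ((i - 0ℚ) * β (k ℕ.∸ a) + 1ℚ * (i * (1ℚ * i′ + 0ℚ))) - 0ℚ * 𝟙 k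
      ≡⟨ regroup (factorial k) i (β (k ℕ.∸ a)) i′ (𝟙 k) ⟩
    (factorial k * i) * (β (k ℕ.∸ a) + i′) ∎
    where
    i = invfact (suc a)
    i′ = invfact (k ℕ.∸ suc a)
    𝟙-gap : ∀ k a → suc a ℕ.< k → 𝟙 (k ℕ.∸ suc a) ≡ 0ℚ
    𝟙-gap (suc (suc k)) zero _ = refl
    𝟙-gap (suc k) (suc a) (s≤s a+1<k) = 𝟙-gap k a a+1<k
    𝟙-gap (suc zero) zero (s≤s ())
    cong₃ : ∀ {l l′ p p′ d d′} → l ≡ l′ → p ≡ p′ → d ≡ d′ →
      factorial k * ((i - 0ℚ) * β (k ℕ.∸ a) + l * (i * (p * i′ + d))) - 0ℚ * 𝟙 k
        ≡ factorial k * ((i - 0ℚ) * β (k ℕ.∸ a) + l′ * (i * (p′ * i′ + d′))) - 0ℚ * 𝟙 k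
    cong₃ refl refl refl = refl
    regroup : ∀ f i b i′ d → f * ((i - 0ℚ) * b + 1ℚ * (i * (1ℚ * i′ + 0ℚ))) - 0ℚ * d ≡ (f * i) * (b + i′)
    regroup = solve-∀ ℚ-ring

  -- the leading coefficient k!/(k+1)! = 1/(k+1)
  ehrhartCoeff-top : ∀ k → 0ℚ < ehrhartCoeff k (suc k)
  ehrhartCoeff-top k = subst (0ℚ <_) (sym value) (pos*pos (factorial-pos k) (invfact-pos (suc k)))
    where
    value : ehrhartCoeff k (suc k) ≡ factorial k * invfact (suc k)
    value = begin
      factorial k * ((invfact (suc k) - 0ℚ) * β (k ℕ.∸ k) + leq (suc k) k * c) - 0ℚ * 𝟙 k
        ≡⟨ cong₂ (λ x y → factorial k * ((invfact (suc k) - 0ℚ) * β x + y * c) - 0ℚ * 𝟙 k) (ℕP.n∸n≡0 k) (leq-no k) ⟩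
      factorial k * ((invfact (suc k) - 0ℚ) * β 0 + 0ℚ * c) - 0ℚ * 𝟙 k
        ≡⟨ cong (λ z → factorial k * ((invfact (suc k) - 0ℚ) * z + 0ℚ * c) - 0ℚ * 𝟙 k) β-0 ⟩
      factorial k * ((invfact (suc k) - 0ℚ) * 1ℚ + 0ℚ * c) - 0ℚ * 𝟙 k
        ≡⟨ regroup (factorial k) (invfact (suc k)) c (𝟙 k) ⟩
      factorial k * invfact (suc k) ∎
      where
      c = invfact (suc k) * (exp 1ℚ ⊕ 𝟙) (k ℕ.∸ suc k)
      regroup : ∀ f i c d → f * ((i - 0ℚ) * 1ℚ + 0ℚ * c) - 0ℚ * d ≡ f * i
      regroup = solve-∀ ℚ-ring

  -- the coefficient of tᵏ (k ≥ 1) is β₁ + 2 = 3/2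
  ehrhartCoeff-diagonal : ∀ a → 0ℚ < ehrhartCoeff (suc a) (suc a)
  ehrhartCoeff-diagonal a = subst (0ℚ <_) (sym value) (toWitness {a? = 0ℚ <? βtable 1 + (1ℚ + 1ℚ)} _)
    where
    k = suc a
    value : ehrhartCoeff k k ≡ βtable 1 + (1ℚ + 1ℚ)
    value = begin
      factorial k * ((invfact k - 0ℚ) * β (suc k ℕ.∸ k) + leq k k * (invfact k * (exp 1ℚ (k ℕ.∸ k) + 𝟙 (k ℕ.∸ k)))) - 0ℚ * 𝟙 k
        ≡⟨ cong₃ (ℕP.m+n∸n≡m 1 k) (leq-yes k k ℕP.≤-refl) (ℕP.n∸n≡0 k) ⟩
      factorial k * ((invfact k - 0ℚ) * β 1 + 1ℚ * (invfact k * (exp 1ℚ 0 + 𝟙 0))) - 0ℚ * 𝟙 k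
        ≡⟨ cong (λ z → factorial k * ((invfact k - 0ℚ) * z + 1ℚ * (invfact k * (exp 1ℚ 0 + 𝟙 0))) - 0ℚ * 𝟙 k)
                (β≡βtable 1 (s≤s z≤n)) ⟩
      factorial k * ((invfact k - 0ℚ) * βtable 1 + 1ℚ * (invfact k * (1ℚ * 1ℚ + 1ℚ))) - 0ℚ * 𝟙 k
        ≡⟨ regroup (factorial k) (invfact k) (βtable 1) (𝟙 k) ⟩
      (factorial k * invfact k) * (βtable 1 + (1ℚ + 1ℚ)) ≡⟨ cong (_* (βtable 1 + (1ℚ + 1ℚ))) (factorial-invfact k) ⟩
      1ℚ * (βtable 1 + (1ℚ + 1ℚ))                        ≡⟨ *-identityˡ _ ⟩
      βtable 1 + (1ℚ + 1ℚ) ∎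
      where
      cong₃ : ∀ {x x′ y y′ z z′} → x ≡ x′ → y ≡ y′ → z ≡ z′ →
        factorial k * ((invfact k - 0ℚ) * β x + y * (invfact k * (exp 1ℚ z + 𝟙 z))) - 0ℚ * 𝟙 k
          ≡ factorial k * ((invfact k - 0ℚ) * β x′ + y′ * (invfact k * (exp 1ℚ z′ + 𝟙 z′))) - 0ℚ * 𝟙 k
      cong₃ refl refl refl = refl
      regroup : ∀ f i b d → f * ((i - 0ℚ) * b + 1ℚ * (i * (1ℚ * 1ℚ + 1ℚ))) - 0ℚ * d ≡ (f * i) * (b + (1ℚ + 1ℚ))
      regroup = solve-∀ ℚ-ring
open CoefficientValues

-- For 1 ≤ j ≤ k − 1 the coefficient of tʲ is (k!/j!)·(β_m + 1/(m−1)!) with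
-- m = k − j + 1 ≥ 2, so its sign is the sign pattern of m.
middle-coeff-signed : ∀ k p → IsEhrhartPolyOfOrderPolytope (Q k) p →
  ∀ j → 1 ℕ.≤ j → j ℕ.≤ k ℕ.∸ 1 → Signed (k ℕ.∸ j ℕ.+ 1) (coeff p j)
middle-coeff-signed zero p ehrhart (suc a) _ ()
middle-coeff-signed (suc k) p ehrhart (suc a) _ a<k =
  subst₂ Signed (ℕP.+-comm 1 n) (sym coeff-value)
    (Signed-scale {c = factorial (suc k) * invfact (suc a)} {x = β (suc n) + invfact n}
                  (pos*pos (factorial-pos (suc k)) (invfact-pos (suc a)))
                  (signOf (suc n) (s≤s (ℕP.m<n⇒0<n∸m a<k))))
  where
  n = k ℕ.∸ a
  coeff-value : coeff p (suc a) ≡ (factorial (suc k) * invfact (suc a)) * (β (suc n) + invfact n)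
  coeff-value = begin
    coeff p (suc a)
      ≡⟨ coeff-ehrhart (suc k) p ehrhart (suc a) (s≤s (s≤s (ℕP.≤-trans (ℕP.<⇒≤ a<k) (ℕP.n≤1+n k)))) ⟩
    ehrhartCoeff (suc k) (suc a)
      ≡⟨ ehrhartCoeff-middle (suc k) a (s≤s a<k) ⟩
    (factorial (suc k) * invfact (suc a)) * (β (suc k ℕ.∸ a) + invfact n)
      ≡⟨ cong (λ z → (factorial (suc k) * invfact (suc a)) * (β z + invfact n)) (ℕP.+-∸-assoc 1 (ℕP.<⇒≤ a<k)) ⟩
    (factorial (suc k) * invfact (suc a)) * (β (suc n) + invfact n) ∎
    where open ≡-Reasoning

coeff-negative-at-20 : ∀ t p → IsEhrhartPolyOfOrderPolytope (Q (20 ℕ.+ t)) p → coeff p (suc t) < 0ℚ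
coeff-negative-at-20 t p ehrhart =
  from (Signed-⇔ (middle-coeff-signed (20 ℕ.+ t) p ehrhart (suc t) (s≤s z≤n) (ℕP.m≤n+m (suc t) 18)))
       (subst NegativeIndex (sym m≡20) (ℕP.≤-refl , divides 5 refl))
  where
  m≡20 : (20 ℕ.+ t) ℕ.∸ suc t ℕ.+ 1 ≡ 20
  m≡20 = cong (ℕ._+ 1) (ℕP.m+n∸n≡m 19 (suc t))

positive⇒small : ∀ k p → IsEhrhartPolyOfOrderPolytope (Q k) p → EhrhartPositive (suc k) p → k ℕ.< 20
positive⇒small k p ehrhart positive = ℕP.≰⇒> large-impossible
  where
  large-impossible : ¬ (20 ℕ.≤ k)
  large-impossible 20≤k = <-asym (coeff-negative-at-20 t p ehrhart′) (positive (suc t) t+1≤k+1)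
    where
    t = k ℕ.∸ 20
    k≡20+t : k ≡ 20 ℕ.+ t
    k≡20+t = sym (ℕP.m+[n∸m]≡n 20≤k)
    ehrhart′ : IsEhrhartPolyOfOrderPolytope (Q (20 ℕ.+ t)) p
    ehrhart′ = subst (λ k → IsEhrhartPolyOfOrderPolytope (Q k) p) k≡20+t ehrhart
    t+1≤k+1 : suc t ℕ.≤ suc k
    t+1≤k+1 = s≤s (subst (t ℕ.≤_) (sym k≡20+t) (ℕP.m≤n+m t 20))

-- for k < 20 no middle index m ≤ k is negative, and the coefficients of
-- t⁰, tᵏ and t^{k+1} are always positive
small⇒positive : ∀ k p → IsEhrhartPolyOfOrderPolytope (Q k) p → k ℕ.< 20 → EhrhartPositive (suc k) p
small⇒positive k p ehrhart k<20 zero _ =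
  subst (0ℚ <_) (sym (trans (coeff-ehrhart k p ehrhart 0 (s≤s z≤n)) (ehrhartCoeff-0 k))) (positive⁻¹ 1ℚ)
small⇒positive k p ehrhart k<20 (suc a) a<k+1 = by-position (ℕP.<-cmp (suc a) k)
  where
  by-position : Tri (suc a ℕ.< k) (suc a ≡ k) (k ℕ.< suc a) → 0ℚ < coeff p (suc a)
  by-position (tri< a+1<k _ _) =
    Signed-positive (λ neg → ℕP.<⇒≱ k<20 (ℕP.≤-trans (proj₁ neg) m≤k))
                    (middle-coeff-signed k p ehrhart (suc a) (s≤s z≤n) (<⇒≤∸1 a+1<k))
    where
    m≤k : k ℕ.∸ suc a ℕ.+ 1 ℕ.≤ k
    m≤k = ℕP.≤-trans (ℕP.+-monoʳ-≤ (k ℕ.∸ suc a) (s≤s z≤n)) (ℕP.≤-reflexive (ℕP.m∸n+n≡m (ℕP.<⇒≤ a+1<k)))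
    <⇒≤∸1 : ∀ {j k} → j ℕ.< k → j ℕ.≤ k ℕ.∸ 1
    <⇒≤∸1 {k = suc k} (s≤s j≤k) = j≤k
  by-position (tri≈ _ a+1≡k _) =
    subst (λ k → IsEhrhartPolyOfOrderPolytope (Q k) p → 0ℚ < coeff p (suc a)) a+1≡k diagonal ehrhart
    where
    diagonal : IsEhrhartPolyOfOrderPolytope (Q (suc a)) p → 0ℚ < coeff p (suc a)
    diagonal ehrhart′ = subst (0ℚ <_) (sym (coeff-ehrhart (suc a) p ehrhart′ (suc a) (ℕP.n≤1+n _)))
                              (ehrhartCoeff-diagonal a)
  by-position (tri> _ _ k<a+1) =
    subst (λ j → 0ℚ < coeff p (suc j)) (ℕP.≤-antisym (ℕP.≤-pred k<a+1) (ℕP.≤-pred a<k+1))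
      (subst (0ℚ <_) (sym (coeff-ehrhart k p ehrhart (suc k) ℕP.≤-refl)) (ehrhartCoeff-top k))

theorem1p5 : (k : ℕ) (p : Poly) → IsEhrhartPolyOfOrderPolytope (Q k) p →
    ((j : ℕ) → 1 ℕ.≤ j → j ℕ.≤ k ℕ.∸ 1 →
      (coeff p j < 0ℚ) ⇔ ((20 ℕ.≤ k ℕ.∸ j ℕ.+ 1) × (4 ∣ k ℕ.∸ j ℕ.+ 1)))
    × (EhrhartPositive (suc k) p ⇔ (k ℕ.< 20))
theorem1p5 k p ehrhart =
  (λ j 1≤j j≤k-1 → Signed-⇔ (middle-coeff-signed k p ehrhart j 1≤j j≤k-1)) ,
  mk⇔ (positive⇒small k p ehrhart) (small⇒positive k p ehrhart)
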